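{- If the graph property $\mathcal{P}$ is $\mathrm{SOL}_g$-definable, then the Harary polynomial $\chi_{\mathcal{P}}(G;x)$ is an $\mathrm{SOL}_g$-definable graph polynomial.
   Context: All graphs are finite simple graphs; a graph property is a class of graphs closed under isomorphism. For a graph $G$, $b_i^{\mathcal{P}}(G)$ is the number of partitions of $V(G)$ into $i$ nonempty blocks each inducing a graph in $\mathcal{P}$, and $\chi_{\mathcal{P}}(G;x)=\sum_i b_i^{\mathcal{P}}(G)\,x_{(i)}$ with $x_{(i)}=x(x-1)\cdots(x-i+1)$. $\mathrm{SOL}_g$ is (full) second-order logic over the language of graphs (one binary edge relation); $\mathcal{P}$ is $\mathrm{SOL}_g$-definable if it is the class of models of an $\mathrm{SOL}_g$-sentence. A multivariate graph polynomial is $\mathrm{SOL}_g$-definable in the sense of Kotek–Makowsky: it is built inductively from expressions of the form $\sum_{R_1,\dots,R_s:\ \phi(\bar R)}\prod_j\prod_{\bar a\in V(G)^{r_j}:\ \psi_j(\bar R,\bar a)}x_j$, where the $R_l$ range over relations on $V(G)$ of fixed arities and $\phi,\psi_j$ are $\mathrm{SOL}_g$-formulas, using sums and products (a linear order on the vertices may be used if the result is independent of the order). A univariate graph polynomial is $\mathrm{SOL}_g$-definable if it is a substitution instance of a multivariate $\mathrm{SOL}_g$-definable one. -}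

module Defs where

open import Data.Bool using (Bool; true; false; _∧_; _∨_; not; T)
open import Data.Nat as ℕ using (ℕ; zero; suc; _<ᵇ_)
open import Data.Fin as Fin using (Fin; toℕ)
open import Data.Fin.Permutation using (Permutation′; _⟨$⟩ʳ_)
open import Data.List as List using (List; []; _∷_; map; filterᵇ; length; allFin; concatMap; foldr; upTo; _++_)
open import Data.Bool.ListAction using (any; all)
open import Data.Vec as Vec using (Vec; []; _∷_)
import Data.Vec.Properties as VecP
open import Data.Integer as ℤ using (ℤ; +_; _+_; _*_; _-_; _^_)
open import Data.Product using (Σ; _×_; _,_)
open import Relation.Binary.PropositionalEquality using (_≡_; refl; cong)
open import Relation.Nullary.Decidable using (⌊_⌋)

record Graph : Set where
  field
    size   : ℕ
    adj    : Fin size → Fin size → Bool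
    sym    : ∀ u v → adj u v ≡ adj v u
    irrefl : ∀ v → adj v v ≡ false
open Graph public

-- induced subgraph on a (duplicate-free) list of vertices
induced : (G : Graph) → List (Fin (size G)) → Graph
induced G vs = record
  { size   = length vs
  ; adj    = λ a b → adj G (List.lookup vs a) (List.lookup vs b)
  ; sym    = λ a b → sym G (List.lookup vs a) (List.lookup vs b)
  ; irrefl = λ a → irrefl G (List.lookup vs a)
  }

allVecs : ∀ {A : Set} → List A → (k : ℕ) → List (Vec A k)
allVecs xs zero    = [] ∷ []
allVecs xs (suc k) = concatMap (λ x → map (x ∷_) (allVecs xs k)) xs

sublists : ∀ {A : Set} → List A → List (List A)
sublists []       = [] ∷ []
sublists (x ∷ xs) = map (x ∷_) (sublists xs) ++ sublists xs

_=ᶠ_ : ∀ {n} → Fin n → Fin n → Bool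
a =ᶠ b = ⌊ a Fin.≟ b ⌋

_=ᵛ_ : ∀ {n k} → Vec (Fin n) k → Vec (Fin n) k → Bool
u =ᵛ v = ⌊ VecP.≡-dec Fin._≟_ u v ⌋

Rel : ℕ → ℕ → Set
Rel n k = Vec (Fin n) k → Bool

allRels : (n k : ℕ) → List (Rel n k)
allRels n k = map (λ S t → any (t =ᵛ_) S) (sublists (allVecs (allFin n) k))

-- First-order variables: de Bruijn indices Fin m.
-- Second-order variables: de Bruijn indices into a list Γ of arities.
-- The flag o says whether the extra order symbol `less` is available
-- (o = false: the pure language of graphs, SOL_g).

data _∋_ : List ℕ → ℕ → Set where
  here  : ∀ {Γ k} → (k ∷ Γ) ∋ k
  there : ∀ {Γ k l} → Γ ∋ k → (l ∷ Γ) ∋ k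

data Formula (o : Bool) (m : ℕ) (Γ : List ℕ) : Set where
  edge  : Fin m → Fin m → Formula o m Γ
  equal : Fin m → Fin m → Formula o m Γ
  less  : T o → Fin m → Fin m → Formula o m Γ
  rel   : ∀ {k} → Γ ∋ k → Vec (Fin m) k → Formula o m Γ
  neg   : Formula o m Γ → Formula o m Γ
  conj  : Formula o m Γ → Formula o m Γ → Formula o m Γ
  disj  : Formula o m Γ → Formula o m Γ → Formula o m Γ
  ex₁   : Formula o (suc m) Γ → Formula o m Γ
  all₁  : Formula o (suc m) Γ → Formula o m Γ
  ex₂   : (k : ℕ) → Formula o m (k ∷ Γ) → Formula o m Γ
  all₂  : (k : ℕ) → Formula o m (k ∷ Γ) → Formula o m Γ

REnv : ℕ → List ℕ → Set
REnv n Γ = (k : ℕ) → Γ ∋ k → Rel n k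

emptyEnv : ∀ {n} → REnv n []
emptyEnv k ()

extEnv : ∀ {n k Γ} → Rel n k → REnv n Γ → REnv n (k ∷ Γ)
extEnv R ρ _ here      = R
extEnv R ρ k (there x) = ρ k x

allEnvs : (n : ℕ) (Γ : List ℕ) → List (REnv n Γ)
allEnvs n []      = emptyEnv ∷ []
allEnvs n (k ∷ Γ) = concatMap (λ R → map (extEnv R) (allEnvs n Γ)) (allRels n k)

extVal : ∀ {m n} → Fin n → (Fin m → Fin n) → Fin (suc m) → Fin n
extVal a v Fin.zero    = a
extVal a v (Fin.suc i) = v i

eval : ∀ {o m Γ} (G : Graph) → (Fin (size G) → Fin (size G) → Bool) →
       (Fin m → Fin (size G)) → REnv (size G) Γ → Formula o m Γ → Bool
eval G ord v ρ (edge a b)  = adj G (v a) (v b)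
eval G ord v ρ (equal a b) = v a =ᶠ v b
eval G ord v ρ (less _ a b) = ord (v a) (v b)
eval G ord v ρ (rel {k} R as) = ρ k R (Vec.map v as)
eval G ord v ρ (neg φ)     = not (eval G ord v ρ φ)
eval G ord v ρ (conj φ ψ)  = eval G ord v ρ φ ∧ eval G ord v ρ ψ
eval G ord v ρ (disj φ ψ)  = eval G ord v ρ φ ∨ eval G ord v ρ ψ
eval G ord v ρ (ex₁ φ)     = any (λ a → eval G ord (extVal a v) ρ φ) (allFin (size G))
eval G ord v ρ (all₁ φ)    = all (λ a → eval G ord (extVal a v) ρ φ) (allFin (size G))
eval G ord v ρ (ex₂ k φ)   = any (λ R → eval G ord v (extEnv R ρ) φ) (allRels (size G) k)
eval G ord v ρ (all₂ k φ)  = all (λ R → eval G ord v (extEnv R ρ) φ) (allRels (size G) k)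

-- SOL_g sentences (no order symbol, no free variables)
Sentence : Set
Sentence = Formula false 0 []

noVars : ∀ {n} → Fin 0 → Fin n
noVars ()

models : Sentence → Graph → Bool
models φ G = eval G (λ _ _ → false) noVars emptyEnv φ

SOLDefinableProperty : (Graph → Bool) → Set
SOLDefinableProperty P = Σ Sentence λ φ → ∀ G → P G ≡ models φ G

-- Partitions of Fin n into i nonempty blocks, represented canonically by
-- block-labellings f : Fin n → Fin i that are surjective and label blocks
-- in increasing order of their least element (restricted growth strings).
isCanonicalPartition : ∀ {n i} → Vec (Fin i) n → Bool
isCanonicalPartition {n} {i} f =
  all (λ b → any (λ v → Vec.lookup f v =ᶠ b) (allFin n)) (allFin i) ∧
  all (λ v → all (λ b → not (toℕ b <ᵇ toℕ (Vec.lookup f v)) ∨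
                        any (λ u → (toℕ u <ᵇ toℕ v) ∧ (Vec.lookup f u =ᶠ b)) (allFin n))
                 (allFin i))
      (allFin n)

block : (G : Graph) {i : ℕ} → Vec (Fin i) (size G) → Fin i → List (Fin (size G))
block G f b = filterᵇ (λ v → Vec.lookup f v =ᶠ b) (allFin (size G))

bCount : (Graph → Bool) → Graph → ℕ → ℕ
bCount P G i =
  length (filterᵇ (λ f → isCanonicalPartition f ∧ all (λ b → P (induced G (block G f b))) (allFin i))
                  (allVecs (allFin i) (size G)))

fall : ℤ → ℕ → ℤ
fall x zero    = + 1
fall x (suc i) = fall x i * (x - + i)

sumℤ : List ℤ → ℤ
sumℤ = foldr _+_ (+ 0)

productℤ : List ℤ → ℤ
productℤ = foldr _*_ (+ 1)

-- univariate integer graph polynomials, given by their evaluation maps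
-- (a polynomial in ℤ[x] is determined by its values on ℤ)
GraphPoly : Set
GraphPoly = Graph → ℤ → ℤ

-- χ_P(G;x) = Σ_i b_i^P(G) x_(i)   (b_i = 0 for i > |V(G)|)
harary : (Graph → Bool) → GraphPoly
harary P G x = sumℤ (map (λ i → + bCount P G i * fall x i) (upTo (suc (size G))))

-- SOL_g-definable graph polynomials (Kotek–Makowsky), in k indeterminates
-- x_0,...,x_{k-1}; formulas may use the order symbol.

record Factor (k : ℕ) (Γ : List ℕ) : Set where
  constructor factor
  field
    arity : ℕ
    cond  : Formula true arity Γ
    var   : Fin k

data PolyExpr (k : ℕ) : Set where
  -- Σ_{R̄ : φ(R̄)} Π_j Π_{ā : ψ_j(R̄,ā)} x_j, R̄ of arities Γ
  basic : (Γ : List ℕ) → Formula true 0 Γ → List (Factor k Γ) → PolyExpr k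
  plus  : PolyExpr k → PolyExpr k → PolyExpr k
  times : PolyExpr k → PolyExpr k → PolyExpr k

⟦_⟧ : ∀ {k} → PolyExpr k → (G : Graph) → (Fin (size G) → Fin (size G) → Bool) →
      (Fin k → ℤ) → ℤ
⟦ basic Γ φ fs ⟧ G ord ρ =
  sumℤ (map (λ R → productℤ (map (λ F → ρ (Factor.var F) ^
                 length (filterᵇ (λ as → eval G ord (λ i → Vec.lookup as i) R (Factor.cond F))
                                 (allVecs (allFin (size G)) (Factor.arity F))))
               fs))
            (filterᵇ (λ R → eval G ord noVars R φ) (allEnvs (size G) Γ)))
⟦ plus e₁ e₂ ⟧ G ord ρ  = ⟦ e₁ ⟧ G ord ρ + ⟦ e₂ ⟧ G ord ρ
⟦ times e₁ e₂ ⟧ G ord ρ = ⟦ e₁ ⟧ G ord ρ * ⟦ e₂ ⟧ G ord ρ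

-- the linear order on Fin n induced by a permutation (every linear order
-- on a finite set arises this way)
orderOf : ∀ {n} → Permutation′ n → Fin n → Fin n → Bool
orderOf π a b = toℕ (π ⟨$⟩ʳ a) <ᵇ toℕ (π ⟨$⟩ʳ b)

OrderInvariant : ∀ {k} → PolyExpr k → Set
OrderInvariant e = ∀ G (π π′ : Permutation′ (size G)) ρ →
  ⟦ e ⟧ G (orderOf π) ρ ≡ ⟦ e ⟧ G (orderOf π′) ρ

-- univariate polynomials in ℤ[x] as ascending coefficient lists
evalPoly : List ℤ → ℤ → ℤ
evalPoly []       x = + 0
evalPoly (c ∷ cs) x = c + x * evalPoly cs x

-- a univariate graph polynomial is SOL_g-definable if it is a substitution
-- instance x_j ↦ q_j(x) of an SOL_g-definable multivariate one
SOLDefinablePoly : GraphPoly → Set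
SOLDefinablePoly Q =
  Σ ℕ λ k → Σ (PolyExpr k) λ e → Σ (Fin k → List ℤ) λ q →
    OrderInvariant e ×
    (∀ G (π : Permutation′ (size G)) x →
       Q G x ≡ ⟦ e ⟧ G (orderOf π) (λ j → evalPoly (q j) x))

-- χ_P(G; x) is a sum over the partitions of V(G) into blocks satisfying P, each partition
-- counted once through its canonical (restricted growth) labelling. In second-order logic a
-- partition is an equivalence relation E whose classes satisfy the relativised sentence, and
-- the factor x_(i) = ∏_{j<i} (x - j) is produced by a second relation C: ordering the classes
-- by their least elements (for an arbitrary linear order), C lets the least element of the
-- j-th class point to itself, with weight x₀, or to one of the j earlier least elements, with
-- weight x₁, and fixes all other vertices. Summing over C gives ∏_{j<i} (x₀ + j x₁), which is
-- x_(i) at x₀ = x, x₁ = -1 and does not depend on the order.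

module Submission where

open import Defs hiding (sym)
open import Data.Bool using (Bool; true; false; _∧_; _∨_; not; if_then_else_; T)
import Data.Bool.Properties as BoolP
open import Data.Bool.ListAction using (any; all)
open import Data.Nat as ℕ using (ℕ; zero; suc; _<ᵇ_; _≡ᵇ_)
import Data.Nat.Properties as ℕP
open import Data.Fin as Fin using (Fin; toℕ)
import Data.Fin.Properties as FinP
open import Data.Fin.Permutation using (Permutation′; _⟨$⟩ʳ_; _⟨$⟩ˡ_; inverseˡ)
open import Data.List as List using (List; []; _∷_; map; filterᵇ; length; allFin; concatMap; upTo; _++_)
import Data.List.Properties as ListP
import Data.List.Extrema as Extrema
import Data.List.Relation.Unary.Any as Any
open Any using () renaming (here to ahere; there to athere)
import Data.List.Relation.Unary.Any.Properties as AnyP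
import Data.List.Relation.Unary.All as AllP
open AllP using () renaming ([] to a[])
open import Data.List.Relation.Unary.All.Properties using (All¬⇒¬Any)
open import Data.List.Relation.Unary.AllPairs using () renaming ([] to u[]; _∷_ to _u∷_)
open import Data.List.Relation.Unary.Unique.Propositional using (Unique)
import Data.List.Relation.Unary.Unique.Propositional.Properties as UniqueP
open import Data.List.Membership.Propositional using (_∈_; _∉_)
import Data.List.Membership.Propositional.Properties as ∈P
open import Data.Vec as Vec using (Vec; []; _∷_)
import Data.Vec.Properties as VecP
open import Data.Integer using (ℤ; +_; _+_; _*_; _^_; -_)
import Data.Integer.Properties as ℤP
open import Data.Product using (∃; _×_; _,_; proj₁; proj₂)
open import Data.Sum using (_⊎_; inj₁; inj₂)
open import Data.Empty using (⊥-elim)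
open import Data.Unit using (tt)
open import Function using (_∘_; id)
open import Relation.Binary.PropositionalEquality hiding (isEquivalence)
import Algebra.Properties.CommutativeSemigroup as CSG
open import Relation.Nullary using (yes; no; ¬_)
open import Relation.Nullary.Decidable using (⌊_⌋; T?)
open import Relation.Binary.Definitions using (DecidableEquality; tri<; tri≈; tri>)

bool-ext : ∀ {a b : Bool} → (a ≡ true → b ≡ true) → (b ≡ true → a ≡ true) → a ≡ b
bool-ext {true}  {true}  f g = refl
bool-ext {true}  {false} f g = sym (f refl)
bool-ext {false} {true}  f g = g refl
bool-ext {false} {false} f g = refl

true≢false : true ≢ false
true≢false ()

∧-elimˡ : ∀ {a b} → a ∧ b ≡ true → a ≡ true
∧-elimˡ {true} _ = refl

∧-elimʳ : ∀ a {b} → a ∧ b ≡ true → b ≡ true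
∧-elimʳ true p = p

∧-intro : ∀ {a b} → a ≡ true → b ≡ true → a ∧ b ≡ true
∧-intro refl refl = refl

not-true⇒false : ∀ {a} → not a ≡ true → a ≡ false
not-true⇒false {false} _ = refl

false⇒not-true : ∀ {a} → a ≡ false → not a ≡ true
false⇒not-true refl = refl

_==_ : Bool → Bool → Bool
true  == b = b
false == b = not b

==⇒≡ : ∀ {a b} → (a == b) ≡ true → a ≡ b
==⇒≡ {true}  {true}  _ = refl
==⇒≡ {false} {false} _ = refl

==-refl : ∀ a → (a == a) ≡ true
==-refl true  = refl
==-refl false = refl

module _ {A : Set} (_≟_ : DecidableEquality A) where

  ⌊≟⌋-refl : ∀ a → ⌊ a ≟ a ⌋ ≡ true
  ⌊≟⌋-refl a with a ≟ a
  ... | yes _ = refl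
  ... | no a≢a = ⊥-elim (a≢a refl)

  ⌊≟⌋⇒≡ : ∀ {a b} → ⌊ a ≟ b ⌋ ≡ true → a ≡ b
  ⌊≟⌋⇒≡ {a} {b} p with a ≟ b
  ... | yes a≡b = a≡b

  ≢⇒⌊≟⌋-false : ∀ {a b} → a ≢ b → ⌊ a ≟ b ⌋ ≡ false
  ≢⇒⌊≟⌋-false {a} {b} a≢b with a ≟ b
  ... | yes a≡b = ⊥-elim (a≢b a≡b)
  ... | no _ = refl

module _ {n : ℕ} where

  =ᶠ-refl : (a : Fin n) → (a =ᶠ a) ≡ true
  =ᶠ-refl = ⌊≟⌋-refl Fin._≟_

  =ᶠ⇒≡ : {a b : Fin n} → (a =ᶠ b) ≡ true → a ≡ b
  =ᶠ⇒≡ = ⌊≟⌋⇒≡ Fin._≟_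

  ≢⇒=ᶠ-false : {a b : Fin n} → a ≢ b → (a =ᶠ b) ≡ false
  ≢⇒=ᶠ-false = ≢⇒⌊≟⌋-false Fin._≟_

  =ᶠ-false⇒≢ : {a b : Fin n} → (a =ᶠ b) ≡ false → a ≢ b
  =ᶠ-false⇒≢ {a} p refl = true≢false (trans (sym (=ᶠ-refl a)) p)

  =ᶠ-sym : (a b : Fin n) → (a =ᶠ b) ≡ (b =ᶠ a)
  =ᶠ-sym a b = bool-ext (λ p → subst (λ z → (b =ᶠ z) ≡ true) (sym (=ᶠ⇒≡ p)) (=ᶠ-refl b))
                        (λ p → subst (λ z → (a =ᶠ z) ≡ true) (sym (=ᶠ⇒≡ p)) (=ᶠ-refl a))

module _ {n k : ℕ} where

  =ᵛ-refl : (t : Vec (Fin n) k) → (t =ᵛ t) ≡ true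
  =ᵛ-refl = ⌊≟⌋-refl (VecP.≡-dec Fin._≟_)

  =ᵛ⇒≡ : {s t : Vec (Fin n) k} → (s =ᵛ t) ≡ true → s ≡ t
  =ᵛ⇒≡ = ⌊≟⌋⇒≡ (VecP.≡-dec Fin._≟_)

  ≢⇒=ᵛ-false : {s t : Vec (Fin n) k} → s ≢ t → (s =ᵛ t) ≡ false
  ≢⇒=ᵛ-false = ≢⇒⌊≟⌋-false (VecP.≡-dec Fin._≟_)

module _ {A : Set} {p : A → Bool} where

  any-intro : ∀ {x} xs → x ∈ xs → p x ≡ true → any p xs ≡ true
  any-intro (y ∷ xs) (ahere refl) px rewrite px = refl
  any-intro (y ∷ xs) (athere x∈xs) px with p y
  ... | true  = refl
  ... | false = any-intro xs x∈xs px

  any-elim : ∀ xs → any p xs ≡ true → ∃ λ x → x ∈ xs × p x ≡ true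
  any-elim (y ∷ xs) e with p y in py
  ... | true  = y , ahere refl , py
  ... | false = let (x , x∈xs , px) = any-elim xs e in x , athere x∈xs , px

  all-intro : ∀ xs → (∀ x → x ∈ xs → p x ≡ true) → all p xs ≡ true
  all-intro []       h = refl
  all-intro (y ∷ xs) h = ∧-intro (h y (ahere refl)) (all-intro xs (λ x m → h x (athere m)))

  all-elim : ∀ {x} xs → all p xs ≡ true → x ∈ xs → p x ≡ true
  all-elim (y ∷ xs) e (ahere refl) = ∧-elimˡ e
  all-elim (y ∷ xs) e (athere m)   = all-elim xs (∧-elimʳ (p y) e) m

module _ {A : Set} {p q : A → Bool} where

  any-cong : (∀ a → p a ≡ q a) → ∀ xs → any p xs ≡ any q xs
  any-cong e xs = cong (List.foldr _∨_ false) (ListP.map-cong e xs)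

  all-cong : (∀ a → p a ≡ q a) → ∀ xs → all p xs ≡ all q xs
  all-cong e xs = cong (List.foldr _∧_ true) (ListP.map-cong e xs)

  all-cong-∈ : ∀ xs → (∀ a → a ∈ xs → p a ≡ q a) → all p xs ≡ all q xs
  all-cong-∈ []       e = refl
  all-cong-∈ (x ∷ xs) e = cong₂ _∧_ (e x (ahere refl)) (all-cong-∈ xs (λ a m → e a (athere m)))

  filterᵇ-cong : (∀ a → p a ≡ q a) → ∀ xs → filterᵇ p xs ≡ filterᵇ q xs
  filterᵇ-cong e []       = refl
  filterᵇ-cong e (x ∷ xs) with p x | q x | e x
  ... | true  | true  | _ = cong (x ∷_) (filterᵇ-cong e xs)
  ... | false | false | _ = filterᵇ-cong e xs

all-map : ∀ {A B : Set} (p : B → Bool) (f : A → B) xs → all p (map f xs) ≡ all (p ∘ f) xs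
all-map p f xs = cong (List.foldr _∧_ true) (sym (ListP.map-∘ xs))

all-concatMap : ∀ {A B : Set} (p : B → Bool) (h : A → List B) xs →
  all p (concatMap h xs) ≡ all (λ a → all p (h a)) xs
all-concatMap p h []       = refl
all-concatMap p h (x ∷ xs) = trans (all-++ (h x)) (cong (all p (h x) ∧_) (all-concatMap p h xs))
  where
  all-++ : ∀ ys {zs} → all p (ys ++ zs) ≡ all p ys ∧ all p zs
  all-++ []       = refl
  all-++ (y ∷ ys) = trans (cong (p y ∧_) (all-++ ys)) (sym (BoolP.∧-assoc (p y) _ _))

module _ {A : Set} (p : A → Bool) where

  ∈-filterᵇ⁺ : ∀ {x} xs → x ∈ xs → p x ≡ true → x ∈ filterᵇ p xs
  ∈-filterᵇ⁺ (y ∷ xs) (ahere refl) px rewrite px = ahere refl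
  ∈-filterᵇ⁺ (y ∷ xs) (athere m) px with p y
  ... | true  = athere (∈-filterᵇ⁺ xs m px)
  ... | false = ∈-filterᵇ⁺ xs m px

  ∈-filterᵇ⁻ : ∀ {x} xs → x ∈ filterᵇ p xs → x ∈ xs × p x ≡ true
  ∈-filterᵇ⁻ (y ∷ xs) m with p y in py
  ∈-filterᵇ⁻ (y ∷ xs) (ahere refl) | true = ahere refl , py
  ∈-filterᵇ⁻ (y ∷ xs) (athere m)   | true = let (m′ , px) = ∈-filterᵇ⁻ xs m in athere m′ , px
  ... | false = let (m′ , px) = ∈-filterᵇ⁻ xs m in athere m′ , px

  filterᵇ⁺ : ∀ {xs} → Unique xs → Unique (filterᵇ p xs)
  filterᵇ⁺ = UniqueP.filter⁺ (T? ∘ p)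

module _ {A B : Set} (h : A → List B) where

  ∈-concatMap⁺ : ∀ {x y} xs → x ∈ xs → y ∈ h x → y ∈ concatMap h xs
  ∈-concatMap⁺ (x ∷ xs) (ahere refl) m = ∈P.∈-++⁺ˡ m
  ∈-concatMap⁺ (x ∷ xs) (athere mx)  m = ∈P.∈-++⁺ʳ (h x) (∈-concatMap⁺ xs mx m)

  ∈-concatMap⁻ : ∀ {y} xs → y ∈ concatMap h xs → ∃ λ x → x ∈ xs × y ∈ h x
  ∈-concatMap⁻ (x ∷ xs) m with ∈P.∈-++⁻ (h x) m
  ... | inj₁ q = x , ahere refl , q
  ... | inj₂ q = let (z , mz , q′) = ∈-concatMap⁻ xs q in z , athere mz , q′

∈-allVecs : ∀ {A : Set} {xs : List A} → (∀ x → x ∈ xs) → ∀ {k} (v : Vec A k) → v ∈ allVecs xs k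
∈-allVecs total []      = ahere refl
∈-allVecs total (x ∷ v) = ∈-concatMap⁺ _ _ (total x) (∈P.∈-map⁺ (x ∷_) (∈-allVecs total v))

allVecs-unique : ∀ {A : Set} {xs : List A} → Unique xs → ∀ k → Unique (allVecs xs k)
allVecs-unique ux zero    = a[] u∷ u[]
allVecs-unique {xs = xs} ux (suc k) = go ux
  where
  ys = allVecs xs k
  head∈ : ∀ {v} zs → v ∈ concatMap (λ x → map (x ∷_) ys) zs → Vec.head v ∈ zs
  head∈ zs m = let (z , mz , q) = ∈-concatMap⁻ _ zs m
                   (w , _ , e) = ∈P.∈-map⁻ (z ∷_) q
               in subst (_∈ zs) (sym (cong Vec.head e)) mz
  go : ∀ {zs} → Unique zs → Unique (concatMap (λ x → map (x ∷_) ys) zs)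
  go u[] = u[]
  go {z ∷ zs} (z∉zs u∷ uz) =
    UniqueP.++⁺ (UniqueP.map⁺ (cong Vec.tail) (allVecs-unique ux k)) (go uz)
      λ (m , m′) → let (w , _ , e) = ∈P.∈-map⁻ (z ∷_) m
                   in All¬⇒¬Any z∉zs (subst (_∈ zs) (cong Vec.head e) (head∈ zs m′))

allTuples : ∀ n k → List (Vec (Fin n) k)
allTuples n k = allVecs (allFin n) k

∈-allTuples : ∀ {n k} (t : Vec (Fin n) k) → t ∈ allTuples n k
∈-allTuples = ∈-allVecs ∈P.∈-allFin

allTuples-unique : ∀ n k → Unique (allTuples n k)
allTuples-unique n k = allVecs-unique (UniqueP.allFin⁺ n) k

sublists-⊆ : ∀ {A : Set} (xs : List A) {S} → S ∈ sublists xs → ∀ {y} → y ∈ S → y ∈ xs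
sublists-⊆ []       (ahere refl) ()
sublists-⊆ (x ∷ xs) m y∈S with ∈P.∈-++⁻ (map (x ∷_) (sublists xs)) m
... | inj₂ q = athere (sublists-⊆ xs q y∈S)
... | inj₁ q with ∈P.∈-map⁻ (x ∷_) q
... | S′ , S′∈ , refl with y∈S
... | ahere e  = ahere e
... | athere m′ = athere (sublists-⊆ xs S′∈ m′)

filterᵇ∈sublists : ∀ {A : Set} (p : A → Bool) xs → filterᵇ p xs ∈ sublists xs
filterᵇ∈sublists p []       = ahere refl
filterᵇ∈sublists p (x ∷ xs) with p x
... | true  = ∈P.∈-++⁺ˡ (∈P.∈-map⁺ (x ∷_) (filterᵇ∈sublists p xs))
... | false = ∈P.∈-++⁺ʳ (map (x ∷_) (sublists xs)) (filterᵇ∈sublists p xs)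

lookup-injective : ∀ {A : Set} {xs : List A} → Unique xs → ∀ {i j} →
  List.lookup xs i ≡ List.lookup xs j → i ≡ j
lookup-injective (_ u∷ _) {Fin.zero} {Fin.zero} e = refl
lookup-injective (x∉ u∷ _) {Fin.zero} {Fin.suc j} e = ⊥-elim (All¬⇒¬Any x∉ (subst (_∈ _) (sym e) (∈P.∈-lookup j)))
lookup-injective (x∉ u∷ _) {Fin.suc i} {Fin.zero} e = ⊥-elim (All¬⇒¬Any x∉ (subst (_∈ _) e (∈P.∈-lookup i)))
lookup-injective (_ u∷ u) {Fin.suc i} {Fin.suc j} e = cong Fin.suc (lookup-injective u e)

∑ : ∀ {A : Set} → (A → ℤ) → List A → ℤ
∑ g xs = sumℤ (map g xs)

∏ : ∀ {A : Set} → (A → ℤ) → List A → ℤ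
∏ g xs = productℤ (map g xs)

∏ᶠ : (k : ℕ) → (Fin k → ℤ) → ℤ
∏ᶠ zero    g = + 1
∏ᶠ (suc k) g = g Fin.zero * ∏ᶠ k (g ∘ Fin.suc)

𝟙 : Bool → ℤ
𝟙 b = if b then + 1 else + 0

module _ {A : Set} where

  ∑-cong : {g h : A → ℤ} → (∀ a → g a ≡ h a) → ∀ xs → ∑ g xs ≡ ∑ h xs
  ∑-cong e xs = cong sumℤ (ListP.map-cong e xs)

  ∑-cong-∈ : {g h : A → ℤ} → ∀ xs → (∀ a → a ∈ xs → g a ≡ h a) → ∑ g xs ≡ ∑ h xs
  ∑-cong-∈ []       e = refl
  ∑-cong-∈ (x ∷ xs) e = cong₂ _+_ (e x (ahere refl)) (∑-cong-∈ xs (λ a m → e a (athere m)))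

  ∑-zero : (xs : List A) → ∑ (λ _ → + 0) xs ≡ + 0
  ∑-zero []       = refl
  ∑-zero (x ∷ xs) = trans (ℤP.+-identityˡ _) (∑-zero xs)

  ∑-ones : (xs : List A) → ∑ (λ _ → + 1) xs ≡ + length xs
  ∑-ones []       = refl
  ∑-ones (x ∷ xs) = cong (_+_ (+ 1)) (∑-ones xs)

  ∑-++ : (g : A → ℤ) → ∀ xs ys → ∑ g (xs ++ ys) ≡ ∑ g xs + ∑ g ys
  ∑-++ g []       ys = sym (ℤP.+-identityˡ _)
  ∑-++ g (x ∷ xs) ys = trans (cong (_+_ (g x)) (∑-++ g xs ys)) (sym (ℤP.+-assoc (g x) _ _))

  ∑-+ : (g h : A → ℤ) → ∀ xs → ∑ (λ a → g a + h a) xs ≡ ∑ g xs + ∑ h xs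
  ∑-+ g h []       = refl
  ∑-+ g h (x ∷ xs) = trans (cong (_+_ (g x + h x)) (∑-+ g h xs))
                           (CSG.interchange ℤP.+-commutativeSemigroup (g x) (h x) _ _)

  ∑-*ˡ : (c : ℤ) (g : A → ℤ) → ∀ xs → ∑ (λ a → c * g a) xs ≡ c * ∑ g xs
  ∑-*ˡ c g []       = sym (ℤP.*-zeroʳ c)
  ∑-*ˡ c g (x ∷ xs) = trans (cong (_+_ (c * g x)) (∑-*ˡ c g xs)) (sym (ℤP.*-distribˡ-+ c (g x) _))

  ∑-*ʳ : (c : ℤ) (g : A → ℤ) → ∀ xs → ∑ (λ a → g a * c) xs ≡ ∑ g xs * c
  ∑-*ʳ c g xs = trans (∑-cong (λ a → ℤP.*-comm (g a) c) xs) (trans (∑-*ˡ c g xs) (ℤP.*-comm c _))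

  ∑-filterᵇ : (g : A → ℤ) (p : A → Bool) → ∀ xs → ∑ g (filterᵇ p xs) ≡ ∑ (λ a → if p a then g a else + 0) xs
  ∑-filterᵇ g p []       = refl
  ∑-filterᵇ g p (x ∷ xs) with p x
  ... | true  = cong (_+_ (g x)) (∑-filterᵇ g p xs)
  ... | false = trans (∑-filterᵇ g p xs) (sym (ℤP.+-identityˡ _))

  length-filterᵇ : (p : A → Bool) → ∀ xs → + length (filterᵇ p xs) ≡ ∑ (𝟙 ∘ p) xs
  length-filterᵇ p []       = refl
  length-filterᵇ p (x ∷ xs) with p x
  ... | true  = cong (_+_ (+ 1)) (length-filterᵇ p xs)
  ... | false = trans (length-filterᵇ p xs) (sym (ℤP.+-identityˡ _))

  ∑-if-const : (p : A → Bool) (c : ℤ) → ∀ xs → ∑ (λ a → if p a then c else + 0) xs ≡ c * ∑ (𝟙 ∘ p) xs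
  ∑-if-const p c xs = trans (∑-cong (λ a → sym (c*𝟙 (p a))) xs) (∑-*ˡ c (𝟙 ∘ p) xs)
    where
    c*𝟙 : ∀ b → c * 𝟙 b ≡ (if b then c else + 0)
    c*𝟙 true  = ℤP.*-identityʳ c
    c*𝟙 false = ℤP.*-zeroʳ c

  ∏-cong : {g h : A → ℤ} → (∀ a → g a ≡ h a) → ∀ xs → ∏ g xs ≡ ∏ h xs
  ∏-cong e xs = cong productℤ (ListP.map-cong e xs)

  ∏-cong-∈ : {g h : A → ℤ} → ∀ xs → (∀ a → a ∈ xs → g a ≡ h a) → ∏ g xs ≡ ∏ h xs
  ∏-cong-∈ []       e = refl
  ∏-cong-∈ (x ∷ xs) e = cong₂ _*_ (e x (ahere refl)) (∏-cong-∈ xs (λ a m → e a (athere m)))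

  ∏-ones : {g : A → ℤ} → ∀ xs → (∀ a → a ∈ xs → g a ≡ + 1) → ∏ g xs ≡ + 1
  ∏-ones []       e = refl
  ∏-ones (x ∷ xs) e = trans (cong₂ _*_ (e x (ahere refl)) (∏-ones xs (λ a m → e a (athere m)))) (ℤP.*-identityˡ _)

  ∏-++ : (g : A → ℤ) → ∀ xs ys → ∏ g (xs ++ ys) ≡ ∏ g xs * ∏ g ys
  ∏-++ g []       ys = sym (ℤP.*-identityˡ _)
  ∏-++ g (x ∷ xs) ys = trans (cong (g x *_) (∏-++ g xs ys)) (sym (ℤP.*-assoc (g x) _ _))

  ∏-* : (g h : A → ℤ) → ∀ xs → ∏ (λ a → g a * h a) xs ≡ ∏ g xs * ∏ h xs
  ∏-* g h []       = refl
  ∏-* g h (x ∷ xs) = trans (cong ((g x * h x) *_) (∏-* g h xs))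
                           (CSG.interchange ℤP.*-commutativeSemigroup (g x) (h x) _ _)

  ^-length-filterᵇ : (y : ℤ) (p : A → Bool) → ∀ xs → y ^ length (filterᵇ p xs) ≡ ∏ (λ a → if p a then y else + 1) xs
  ^-length-filterᵇ y p []       = refl
  ^-length-filterᵇ y p (x ∷ xs) with p x
  ... | true  = cong (y *_) (^-length-filterᵇ y p xs)
  ... | false = trans (^-length-filterᵇ y p xs) (sym (ℤP.*-identityˡ _))

  𝟙-all : (p : A → Bool) → ∀ xs → 𝟙 (all p xs) ≡ ∏ (𝟙 ∘ p) xs
  𝟙-all p []       = refl
  𝟙-all p (x ∷ xs) with p x
  ... | true  = trans (𝟙-all p xs) (sym (ℤP.*-identityˡ _))
  ... | false = refl

  if-all≡∏ : (p : A → Bool) (g : A → ℤ) → ∀ xs →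
    (if all p xs then ∏ g xs else + 0) ≡ ∏ (λ a → if p a then g a else + 0) xs
  if-all≡∏ p g []       = refl
  if-all≡∏ p g (x ∷ xs) with p x
  ... | false = sym (ℤP.*-zeroˡ (∏ (λ a → if p a then g a else + 0) xs))
  ... | true  = trans (if-*ˡ (all p xs)) (cong (g x *_) (if-all≡∏ p g xs))
    where
    if-*ˡ : ∀ b → (if b then g x * ∏ g xs else + 0) ≡ g x * (if b then ∏ g xs else + 0)
    if-*ˡ true  = refl
    if-*ˡ false = sym (ℤP.*-zeroʳ (g x))

module _ {A B : Set} where

  ∑-swap : (g : A → B → ℤ) → ∀ xs ys → ∑ (λ a → ∑ (g a) ys) xs ≡ ∑ (λ b → ∑ (λ a → g a b) xs) ys
  ∑-swap g []       ys = sym (∑-zero ys)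
  ∑-swap g (x ∷ xs) ys = trans (cong (_+_ (∑ (g x) ys)) (∑-swap g xs ys))
                               (sym (∑-+ (g x) (λ b → ∑ (λ a → g a b) xs) ys))

  ∑-map : (g : B → ℤ) (h : A → B) → ∀ xs → ∑ g (map h xs) ≡ ∑ (g ∘ h) xs
  ∑-map g h xs = cong sumℤ (sym (ListP.map-∘ xs))

  ∏-map : (g : B → ℤ) (h : A → B) → ∀ xs → ∏ g (map h xs) ≡ ∏ (g ∘ h) xs
  ∏-map g h xs = cong productℤ (sym (ListP.map-∘ xs))

  ∑-concatMap : (g : B → ℤ) (h : A → List B) → ∀ xs → ∑ g (concatMap h xs) ≡ ∑ (λ a → ∑ g (h a)) xs
  ∑-concatMap g h []       = refl
  ∑-concatMap g h (x ∷ xs) = trans (∑-++ g (h x) (concatMap h xs)) (cong (_+_ (∑ g (h x))) (∑-concatMap g h xs))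

  ∏-concatMap : (g : B → ℤ) (h : A → List B) → ∀ xs → ∏ g (concatMap h xs) ≡ ∏ (λ a → ∏ g (h a)) xs
  ∏-concatMap g h []       = refl
  ∏-concatMap g h (x ∷ xs) = trans (∏-++ g (h x) (concatMap h xs)) (cong (∏ g (h x) *_) (∏-concatMap g h xs))

  -- The first hypothesis says that every a with F a ≠ 0 has exactly one δ-partner in ys.
  ∑-double-count : ∀ xs ys (F : A → ℤ) (H : B → ℤ) (δ : A → B → Bool) →
    (∀ a → F a * ∑ (𝟙 ∘ δ a) ys ≡ F a) →
    (∀ b → H b ≡ ∑ (λ a → if δ a b then F a else + 0) xs) →
    ∑ F xs ≡ ∑ H ys
  ∑-double-count xs ys F H δ unique-partner H-fibre = begin
    ∑ F xs                                            ≡⟨ ∑-cong (λ a → sym (unique-partner a)) xs ⟩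
    ∑ (λ a → F a * ∑ (𝟙 ∘ δ a) ys) xs                 ≡⟨ ∑-cong (λ a → sym (∑-*ˡ (F a) (𝟙 ∘ δ a) ys)) xs ⟩
    ∑ (λ a → ∑ (λ b → F a * 𝟙 (δ a b)) ys) xs         ≡⟨ ∑-swap (λ a b → F a * 𝟙 (δ a b)) xs ys ⟩
    ∑ (λ b → ∑ (λ a → F a * 𝟙 (δ a b)) xs) ys         ≡⟨ ∑-cong (λ b → trans (∑-cong (λ a → *𝟙 (F a) (δ a b)) xs) (sym (H-fibre b))) ys ⟩
    ∑ H ys                                            ∎
    where
    open ≡-Reasoning
    *𝟙 : ∀ v b → v * 𝟙 b ≡ (if b then v else + 0)
    *𝟙 v true  = ℤP.*-identityʳ v
    *𝟙 v false = ℤP.*-zeroʳ v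

module _ {A : Set} (_≟_ : DecidableEquality A) where

  ∑-single : ∀ {xs} → Unique xs → ∀ {t} → t ∈ xs → (h : A → ℤ) →
    ∑ (λ a → if ⌊ t ≟ a ⌋ then h a else + 0) xs ≡ h t
  ∑-single {x ∷ xs} (x∉ u∷ u) (ahere refl) h rewrite ⌊≟⌋-refl _≟_ x =
    trans (cong (_+_ (h x)) (trans (∑-cong-∈ xs λ a m → cong (λ b → if b then h a else + 0)
                                  (≢⇒⌊≟⌋-false _≟_ λ e → All¬⇒¬Any x∉ (subst (_∈ xs) (sym e) m)))
                                (∑-zero xs)))
          (ℤP.+-identityʳ _)
  ∑-single {x ∷ xs} (x∉ u∷ u) {t} (athere t∈) h rewrite ≢⇒⌊≟⌋-false _≟_ {t} {x} (λ e → All¬⇒¬Any x∉ (subst (_∈ xs) e t∈)) =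
    trans (ℤP.+-identityˡ _) (∑-single u t∈ h)

  ∏-single : ∀ {xs} → Unique xs → ∀ {t} → t ∈ xs → (h : A → ℤ) →
    ∏ (λ a → if ⌊ t ≟ a ⌋ then h a else + 1) xs ≡ h t
  ∏-single {x ∷ xs} (x∉ u∷ u) (ahere refl) h rewrite ⌊≟⌋-refl _≟_ x =
    trans (cong (h x *_) (∏-ones xs λ a m → cong (λ b → if b then h a else + 1)
                           (≢⇒⌊≟⌋-false _≟_ λ e → All¬⇒¬Any x∉ (subst (_∈ xs) (sym e) m))))
          (ℤP.*-identityʳ _)
  ∏-single {x ∷ xs} (x∉ u∷ u) {t} (athere t∈) h rewrite ≢⇒⌊≟⌋-false _≟_ {t} {x} (λ e → All¬⇒¬Any x∉ (subst (_∈ xs) e t∈)) =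
    trans (ℤP.*-identityˡ _) (∏-single u t∈ h)

∏-tabulate : ∀ {A : Set} n (f : Fin n → A) (g : A → ℤ) → ∏ g (List.tabulate f) ≡ ∏ᶠ n (g ∘ f)
∏-tabulate zero    f g = refl
∏-tabulate (suc n) f g = cong (_*_ (g (f Fin.zero))) (∏-tabulate n (f ∘ Fin.suc) g)

∏-allFin : ∀ n (g : Fin n → ℤ) → ∏ g (allFin n) ≡ ∏ᶠ n g
∏-allFin n g = ∏-tabulate n id g

∏ᶠ-cong : ∀ k {g h : Fin k → ℤ} → (∀ j → g j ≡ h j) → ∏ᶠ k g ≡ ∏ᶠ k h
∏ᶠ-cong zero    e = refl
∏ᶠ-cong (suc k) e = cong₂ _*_ (e Fin.zero) (∏ᶠ-cong k (e ∘ Fin.suc))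

∏ᶠ-ones : ∀ k {g : Fin k → ℤ} → (∀ j → g j ≡ + 1) → ∏ᶠ k g ≡ + 1
∏ᶠ-ones zero    e = refl
∏ᶠ-ones (suc k) e = trans (cong₂ _*_ (e Fin.zero) (∏ᶠ-ones k (e ∘ Fin.suc))) (ℤP.*-identityˡ _)

∑-allVecs-∏ᶠ : ∀ {A : Set} (xs : List A) k (g : Fin k → A → ℤ) →
  ∑ (λ c → ∏ᶠ k (λ j → g j (Vec.lookup c j))) (allVecs xs k) ≡ ∏ᶠ k (λ j → ∑ (g j) xs)
∑-allVecs-∏ᶠ xs zero    g = refl
∑-allVecs-∏ᶠ xs (suc k) g = begin
    ∑ F (concatMap (λ x → map (x ∷_) (allVecs xs k)) xs)
  ≡⟨ ∑-concatMap F _ xs ⟩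
    ∑ (λ x → ∑ F (map (x ∷_) (allVecs xs k))) xs
  ≡⟨ ∑-cong (λ x → trans (∑-map F (x ∷_) (allVecs xs k))
                  (trans (∑-*ˡ (g Fin.zero x) _ (allVecs xs k))
                         (cong (g Fin.zero x *_) (∑-allVecs-∏ᶠ xs k (g ∘ Fin.suc))))) xs ⟩
    ∑ (λ x → g Fin.zero x * ∏ᶠ k (λ j → ∑ (g (Fin.suc j)) xs)) xs
  ≡⟨ ∑-*ʳ _ (g Fin.zero) xs ⟩
    ∑ (g Fin.zero) xs * ∏ᶠ k (λ j → ∑ (g (Fin.suc j)) xs) ∎
  where
  open ≡-Reasoning
  F = λ c → ∏ᶠ (suc k) (λ j → g j (Vec.lookup c j))

module _ {n k : ℕ} where

  _∈ᵇ_ : Vec (Fin n) k → List (Vec (Fin n) k) → Bool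
  t ∈ᵇ S = any (t =ᵛ_) S

  ∈⇒∈ᵇ : ∀ {t S} → t ∈ S → (t ∈ᵇ S) ≡ true
  ∈⇒∈ᵇ {t} {S} t∈S = any-intro S t∈S (=ᵛ-refl t)

  ∈ᵇ⇒∈ : ∀ {t} S → (t ∈ᵇ S) ≡ true → t ∈ S
  ∈ᵇ⇒∈ S e = let (u , u∈S , t≡u) = any-elim S e in subst (_∈ S) (sym (=ᵛ⇒≡ t≡u)) u∈S

  ∉⇒∈ᵇ-false : ∀ {t} S → t ∉ S → (t ∈ᵇ S) ≡ false
  ∉⇒∈ᵇ-false {t} S t∉S with t ∈ᵇ S in e
  ... | false = refl
  ... | true  = ⊥-elim (t∉S (∈ᵇ⇒∈ S e))

  _≐_ : Rel n k → Rel n k → Bool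
  R ≐ Q = all (λ t → R t == Q t) (allTuples n k)

  ≐⇒≗ : ∀ {R Q} → (R ≐ Q) ≡ true → ∀ t → R t ≡ Q t
  ≐⇒≗ e t = ==⇒≡ (all-elim (allTuples n k) e (∈-allTuples t))

  ≗⇒≐ : ∀ {R Q} → (∀ t → R t ≡ Q t) → (R ≐ Q) ≡ true
  ≗⇒≐ {R} {Q} R≗Q = all-intro (allTuples n k) λ t _ → subst (λ b → (R t == b) ≡ true) (R≗Q t) (==-refl (R t))

  allRels-complete : (Q : Rel n k) → ∃ λ R → R ∈ allRels n k × (∀ t → R t ≡ Q t)
  allRels-complete Q = (λ t → t ∈ᵇ S) , ∈P.∈-map⁺ (λ S t → t ∈ᵇ S) (filterᵇ∈sublists Q (allTuples n k)) , agree
    where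
    S = filterᵇ Q (allTuples n k)
    agree : ∀ t → (t ∈ᵇ S) ≡ Q t
    agree t = bool-ext (λ e → proj₂ (∈-filterᵇ⁻ Q (allTuples n k) (∈ᵇ⇒∈ S e)))
                       (λ e → ∈⇒∈ᵇ (∈-filterᵇ⁺ Q (allTuples n k) (∈-allTuples t) e))

  ∑-sublists-agreeing : ∀ L → Unique L → (Q : Vec (Fin n) k → Bool) →
    ∑ (λ S → 𝟙 (all (λ t → (t ∈ᵇ S) == Q t) L)) (sublists L) ≡ + 1
  ∑-sublists-agreeing []       u        Q = refl
  ∑-sublists-agreeing (x ∷ xs) (x∉ u∷ u) Q = begin
      ∑ F (map (x ∷_) (sublists xs) ++ sublists xs)
    ≡⟨ ∑-++ F (map (x ∷_) (sublists xs)) (sublists xs) ⟩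
      ∑ F (map (x ∷_) (sublists xs)) + ∑ F (sublists xs)
    ≡⟨ cong₂ _+_ (trans (∑-map F (x ∷_) (sublists xs)) (∑-cong-∈ (sublists xs) with-x))
                 (∑-cong-∈ (sublists xs) without-x) ⟩
      ∑ (λ S → 𝟙 (Q x ∧ Agree S)) (sublists xs) + ∑ (λ S → 𝟙 (not (Q x) ∧ Agree S)) (sublists xs)
    ≡⟨ split (Q x) ⟩
      + 1 ∎
    where
    open ≡-Reasoning
    F = λ S → 𝟙 (all (λ t → (t ∈ᵇ S) == Q t) (x ∷ xs))
    Agree = λ S → all (λ t → (t ∈ᵇ S) == Q t) xs
    x∉xs : ∀ {t} → t ∈ xs → t ≢ x
    x∉xs t∈xs t≡x = All¬⇒¬Any x∉ (subst (_∈ xs) t≡x t∈xs)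
    with-x : ∀ S → S ∈ sublists xs → F (x ∷ S) ≡ 𝟙 (Q x ∧ Agree S)
    with-x S _ rewrite =ᵛ-refl x =
      cong (λ b → 𝟙 (Q x ∧ b)) (all-cong-∈ xs λ t t∈xs → cong (_== Q t) (cong (_∨ (t ∈ᵇ S)) (≢⇒=ᵛ-false (x∉xs t∈xs))))
    without-x : ∀ S → S ∈ sublists xs → F S ≡ 𝟙 (not (Q x) ∧ Agree S)
    without-x S S∈ = cong (λ b → 𝟙 ((b == Q x) ∧ Agree S))
                          (∉⇒∈ᵇ-false S λ x∈S → All¬⇒¬Any x∉ (sublists-⊆ xs S∈ x∈S))
    split : ∀ b → ∑ (λ S → 𝟙 (b ∧ Agree S)) (sublists xs) + ∑ (λ S → 𝟙 (not b ∧ Agree S)) (sublists xs) ≡ + 1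
    split true  = cong₂ _+_ (∑-sublists-agreeing xs u Q) (∑-zero (sublists xs))
    split false = cong₂ _+_ (∑-zero (sublists xs)) (∑-sublists-agreeing xs u Q)

  ∑-allRels-≐ : (Q : Rel n k) → ∑ (λ R → 𝟙 (R ≐ Q)) (allRels n k) ≡ + 1
  ∑-allRels-≐ Q = trans (∑-map (λ R → 𝟙 (R ≐ Q)) (λ S t → t ∈ᵇ S) (sublists (allTuples n k)))
                        (∑-sublists-agreeing (allTuples n k) (allTuples-unique n k) Q)

module _ {A : Set} where

  count : (A → Bool) → List A → ℕ
  count p xs = length (filterᵇ p xs)

  count-cong-∈ : {p q : A → Bool} → ∀ xs → (∀ a → a ∈ xs → p a ≡ q a) → count p xs ≡ count q xs
  count-cong-∈ [] e = refl
  count-cong-∈ {p} {q} (x ∷ xs) e with p x | q x | e x (ahere refl)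
  ... | true  | true  | _ = cong suc (count-cong-∈ xs (λ a m → e a (athere m)))
  ... | false | false | _ = count-cong-∈ xs (λ a m → e a (athere m))

  count≡0⇒false : {p : A → Bool} → ∀ xs → count p xs ≡ 0 → ∀ {a} → a ∈ xs → p a ≡ false
  count≡0⇒false {p} (x ∷ xs) e m with p x in px
  count≡0⇒false {p} (x ∷ xs) () m           | true
  count≡0⇒false {p} (x ∷ xs) e (ahere refl) | false = px
  count≡0⇒false {p} (x ∷ xs) e (athere m)   | false = count≡0⇒false xs e m

  count≡suc⇒∃ : {p : A → Bool} → ∀ xs {k} → count p xs ≡ suc k → ∃ λ a → a ∈ xs × p a ≡ true
  count≡suc⇒∃ {p} (x ∷ xs) e with p x in px
  ... | true  = x , ahere refl , px
  ... | false = let (a , m , pa) = count≡suc⇒∃ xs e in a , athere m , pa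

  count-∨ : {p p₁ p₂ : A → Bool} → ∀ xs → (∀ a → p a ≡ (p₁ a ∨ p₂ a)) → (∀ a → (p₁ a ∧ p₂ a) ≡ false) →
    count p xs ≡ count p₁ xs ℕ.+ count p₂ xs
  count-∨ [] e d = refl
  count-∨ {p} {p₁} {p₂} (x ∷ xs) e d with p x | p₁ x | p₂ x | e x | d x
  ... | true  | true  | false | _  | _  = cong suc (count-∨ xs e d)
  ... | true  | false | true  | _  | _  = trans (cong suc (count-∨ xs e d)) (sym (ℕP.+-suc _ _))
  ... | false | false | false | _  | _  = count-∨ xs e d
  ... | true  | false | false | () | _
  ... | false | true  | _     | () | _
  ... | false | false | true  | () | _
  ... | _     | true  | true  | _  | ()

  count-mono : {p q : A → Bool} → ∀ xs → (∀ a → p a ≡ true → q a ≡ true) → count p xs ℕ.≤ count q xs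
  count-mono [] h = ℕ.z≤n
  count-mono {p} {q} (x ∷ xs) h with p x in px | q x in qx
  ... | true  | true  = ℕ.s≤s (count-mono xs h)
  ... | true  | false = ⊥-elim (true≢false (trans (sym (h x px)) qx))
  ... | false | true  = ℕP.m≤n⇒m≤1+n (count-mono xs h)
  ... | false | false = count-mono xs h

  count-strict : {p q : A → Bool} → ∀ xs → (∀ a → p a ≡ true → q a ≡ true) →
    ∀ {x} → x ∈ xs → q x ≡ true → p x ≡ false → count p xs ℕ.< count q xs
  count-strict {p} {q} (y ∷ xs) h (ahere refl) qx px rewrite px | qx = ℕ.s≤s (count-mono xs h)
  count-strict {p} {q} (y ∷ xs) h (athere m) qx px with p y in py | q y in qy
  ... | true  | true  = ℕ.s≤s (count-strict xs h m qx px)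
  ... | true  | false = ⊥-elim (true≢false (trans (sym (h y py)) qy))
  ... | false | true  = ℕP.m≤n⇒m≤1+n (count-strict xs h m qx px)
  ... | false | false = count-strict xs h m qx px

  count-single : (_≟_ : DecidableEquality A) → ∀ {xs} → Unique xs → ∀ {t} → t ∈ xs →
    count (λ a → ⌊ t ≟ a ⌋) xs ≡ 1
  count-single _≟_ {xs} u t∈ = ℤP.+-injective (trans (length-filterᵇ _ xs) (∑-single _≟_ u t∈ (λ _ → + 1)))

count-remove : ∀ {n} (R : Fin n → Bool) {m} → R m ≡ true →
  count R (allFin n) ≡ suc (count (λ a → R a ∧ not (a =ᶠ m)) (allFin n))
count-remove {n} R {m} Rm =
  trans (count-∨ (allFin n) split disjoint)
        (trans (cong (count R∖m (allFin n) ℕ.+_) (count-single Fin._≟_ (UniqueP.allFin⁺ n) (∈P.∈-allFin m)))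
               (ℕP.+-comm _ 1))
  where
  R∖m : Fin n → Bool
  R∖m a = R a ∧ not (a =ᶠ m)
  split : ∀ a → R a ≡ (R∖m a ∨ (m =ᶠ a))
  split a rewrite =ᶠ-sym m a with a =ᶠ m in a=m
  ... | true  = trans (subst (λ z → R z ≡ true) (sym (=ᶠ⇒≡ a=m)) Rm) (sym (BoolP.∨-zeroʳ _))
  ... | false = sym (trans (BoolP.∨-identityʳ _) (BoolP.∧-identityʳ _))
  disjoint : ∀ a → (R∖m a ∧ (m =ᶠ a)) ≡ false
  disjoint a rewrite =ᶠ-sym m a with a =ᶠ m
  ... | true  rewrite BoolP.∧-zeroʳ (R a) = refl
  ... | false = BoolP.∧-zeroʳ _

∏-extract : ∀ {A : Set} {xs : List A} → Unique xs → ∀ {m} → m ∈ xs → (g h : A → ℤ) →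
  (∀ a → a ≢ m → g a ≡ h a) → h m ≡ + 1 → ∏ g xs ≡ g m * ∏ h xs
∏-extract {xs = x ∷ xs} (x∉ u∷ u) (ahere refl) g h g≗h hm≡1 =
  cong (g x *_) (trans (∏-cong-∈ xs (λ a a∈ → g≗h a (λ a≡x → All¬⇒¬Any x∉ (subst (_∈ xs) a≡x a∈))))
                       (sym (trans (cong (_* ∏ h xs) hm≡1) (ℤP.*-identityˡ _))))
∏-extract {xs = x ∷ xs} (x∉ u∷ u) {m} (athere m∈) g h g≗h hm≡1 = begin
  g x * ∏ g xs              ≡⟨ cong₂ _*_ (g≗h x (λ x≡m → All¬⇒¬Any x∉ (subst (_∈ xs) (sym x≡m) m∈)))
                                          (∏-extract u m∈ g h g≗h hm≡1) ⟩
  h x * (g m * ∏ h xs)      ≡⟨ CSG.x∙yz≈y∙xz ℤP.*-commutativeSemigroup (h x) (g m) _ ⟩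
  g m * (h x * ∏ h xs)      ∎
  where open ≡-Reasoning

fallingBy : ℤ → ℤ → ℕ → ℤ
fallingBy y₀ y₁ zero    = + 1
fallingBy y₀ y₁ (suc i) = fallingBy y₀ y₁ i * (y₀ + + i * y₁)

fallingBy-−1 : ∀ x i → fallingBy x (- + 1) i ≡ fall x i
fallingBy-−1 x zero    = refl
fallingBy-−1 x (suc i) =
  cong₂ _*_ (fallingBy-−1 x i) (cong (_+_ x) (trans (ℤP.*-comm (+ i) (- + 1)) (ℤP.-1*i≡-i (+ i))))

<ᵇ⇒< : ∀ {m n} → (m <ᵇ n) ≡ true → m ℕ.< n
<ᵇ⇒< {m} {n} e = ℕP.<ᵇ⇒< m n (subst T (sym e) tt)

<⇒<ᵇ : ∀ {m n} → m ℕ.< n → (m <ᵇ n) ≡ true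
<⇒<ᵇ {m} {n} m<n with m <ᵇ n | ℕP.<⇒<ᵇ m<n
... | true | _ = refl

<ᵇ-irrefl : ∀ m → (m <ᵇ m) ≡ false
<ᵇ-irrefl m with m <ᵇ m in e
... | false = refl
... | true  = ⊥-elim (ℕP.<-irrefl refl (<ᵇ⇒< {m} {m} e))

module KeyOrder {n : ℕ} (key : Fin n → ℕ) (key-injective : ∀ {a b} → key a ≡ key b → a ≡ b) where

  _≺_ : Fin n → Fin n → Bool
  a ≺ b = key a <ᵇ key b

  ≺-irrefl : ∀ a → (a ≺ a) ≡ false
  ≺-irrefl a = <ᵇ-irrefl (key a)

  ≺-asym : ∀ {a b} → (a ≺ b) ≡ true → (b ≺ a) ≡ false
  ≺-asym {a} {b} a≺b with b ≺ a in b≺a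
  ... | false = refl
  ... | true  = ⊥-elim (ℕP.<-asym (<ᵇ⇒< {key a} {key b} a≺b) (<ᵇ⇒< {key b} {key a} b≺a))

  ≤∧≢⇒≺ : ∀ {a b} → key a ℕ.≤ key b → a ≢ b → (a ≺ b) ≡ true
  ≤∧≢⇒≺ a≤b a≢b = <⇒<ᵇ (ℕP.≤∧≢⇒< a≤b (a≢b ∘ key-injective))

  module _ (R : Fin n → Bool) {a : Fin n} (Ra : R a ≡ true) where

    private
      module Ex = Extrema ℕP.≤-totalOrder
      candidates = filterᵇ R (allFin n)

      selected : ∀ {x} → (x ≡ a) ⊎ (x ∈ candidates) → R x ≡ true
      selected (inj₁ refl) = Ra
      selected (inj₂ x∈)   = proj₂ (∈-filterᵇ⁻ R (allFin n) x∈)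

      bounded : ∀ {b} → R b ≡ true → b ∈ candidates
      bounded {b} Rb = ∈-filterᵇ⁺ R (allFin n) (∈P.∈-allFin b) Rb

    abstract
      greatest least : Fin n
      greatest = Ex.argmax key a candidates
      least    = Ex.argmin key a candidates

      R-greatest : R greatest ≡ true
      R-greatest = selected (Ex.argmax-sel key a candidates)

      R-least : R least ≡ true
      R-least = selected (Ex.argmin-sel key a candidates)

      least-≤ : ∀ {b} → R b ≡ true → key least ℕ.≤ key b
      least-≤ Rb = AllP.lookup (Ex.f[argmin]≤f[xs] a candidates) (bounded Rb)

      ≺-greatest : ∀ {b} → R b ≡ true → b ≢ greatest → (b ≺ greatest) ≡ true
      ≺-greatest Rb = ≤∧≢⇒≺ (AllP.lookup (Ex.f[xs]≤f[argmax] a candidates) (bounded Rb))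

    least-≺ : ∀ {b} → R b ≡ true → least ≢ b → (least ≺ b) ≡ true
    least-≺ Rb = ≤∧≢⇒≺ (least-≤ Rb)

  rank : (Fin n → Bool) → Fin n → ℕ
  rank R b = count (λ a → R a ∧ a ≺ b) (allFin n)

  rankFactor : ℤ → ℤ → (Fin n → Bool) → Fin n → ℤ
  rankFactor y₀ y₁ R b = if R b then y₀ + + rank R b * y₁ else + 1

  module _ (R : Fin n → Bool) {m : Fin n} (≺m : ∀ {a} → R a ≡ true → a ≢ m → (a ≺ m) ≡ true) where

    private
      R∖m : Fin n → Bool
      R∖m a = R a ∧ not (a =ᶠ m)

    rank-greatest : rank R m ≡ count R∖m (allFin n)
    rank-greatest = count-cong-∈ (allFin n) λ a _ → below-m a
      where
      below-m : ∀ a → (R a ∧ a ≺ m) ≡ R∖m a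
      below-m a with a =ᶠ m in a=m
      ... | true = cong (R a ∧_) (trans (cong (_≺ m) (=ᶠ⇒≡ a=m)) (≺-irrefl m))
      ... | false with R a in Ra
      ...   | true  = ≺m Ra (=ᶠ-false⇒≢ a=m)
      ...   | false = refl

    rank-without-greatest : ∀ {a} → R a ≡ true → a ≢ m → rank R a ≡ rank R∖m a
    rank-without-greatest {a} Ra a≢m = count-cong-∈ (allFin n) λ c _ → below-a c
      where
      below-a : ∀ c → (R c ∧ c ≺ a) ≡ (R∖m c ∧ c ≺ a)
      below-a c with c =ᶠ m in c=m
      ... | true  = trans (cong (R c ∧_) (trans (cong (_≺ a) (=ᶠ⇒≡ c=m)) (≺-asym (≺m Ra a≢m))))
                          (trans (BoolP.∧-zeroʳ (R c)) (sym (cong (_∧ (c ≺ a)) (BoolP.∧-zeroʳ (R c)))))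
      ... | false = cong (_∧ (c ≺ a)) (sym (BoolP.∧-identityʳ (R c)))

  -- Listing the R-elements in ≺-order, the j-th one contributes the factor y₀ + j y₁.
  ∏-rankFactor : ∀ y₀ y₁ k (R : Fin n → Bool) → count R (allFin n) ≡ k →
    ∏ (rankFactor y₀ y₁ R) (allFin n) ≡ fallingBy y₀ y₁ k
  ∏-rankFactor y₀ y₁ zero    R #R≡0 = ∏-ones (allFin n) λ a a∈ →
    cong (λ b → if b then y₀ + + rank R a * y₁ else + 1) (count≡0⇒false (allFin n) #R≡0 a∈)
  ∏-rankFactor y₀ y₁ (suc k) R #R≡1+k = begin
      ∏ (rankFactor y₀ y₁ R) (allFin n)
    ≡⟨ ∏-extract (UniqueP.allFin⁺ n) (∈P.∈-allFin m) (rankFactor y₀ y₁ R) (rankFactor y₀ y₁ R∖m) same-off-m factor-R∖m-m ⟩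
      rankFactor y₀ y₁ R m * ∏ (rankFactor y₀ y₁ R∖m) (allFin n)
    ≡⟨ cong₂ _*_ factor-R-m (∏-rankFactor y₀ y₁ k R∖m #R∖m≡k) ⟩
      (y₀ + + k * y₁) * fallingBy y₀ y₁ k
    ≡⟨ ℤP.*-comm (y₀ + + k * y₁) (fallingBy y₀ y₁ k) ⟩
      fallingBy y₀ y₁ (suc k) ∎
    where
    open ≡-Reasoning
    R-witness = proj₂ (proj₂ (count≡suc⇒∃ (allFin n) #R≡1+k))
    m = greatest R R-witness
    Rm : R m ≡ true
    Rm = R-greatest R R-witness
    R∖m : Fin n → Bool
    R∖m a = R a ∧ not (a =ᶠ m)
    #R∖m≡k : count R∖m (allFin n) ≡ k
    #R∖m≡k = ℕP.suc-injective (trans (sym (count-remove R Rm)) #R≡1+k)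
    factor-R-m : rankFactor y₀ y₁ R m ≡ y₀ + + k * y₁
    factor-R-m rewrite Rm = cong (λ r → y₀ + + r * y₁) (trans (rank-greatest R (≺-greatest R R-witness)) #R∖m≡k)
    factor-R∖m-m : rankFactor y₀ y₁ R∖m m ≡ + 1
    factor-R∖m-m rewrite =ᶠ-refl m | BoolP.∧-zeroʳ (R m) = refl
    same-off-m : ∀ a → a ≢ m → rankFactor y₀ y₁ R a ≡ rankFactor y₀ y₁ R∖m a
    same-off-m a a≢m rewrite ≢⇒=ᶠ-false a≢m | BoolP.∧-identityʳ (R a) with R a in Ra
    ... | false = refl
    ... | true  = cong (λ r → y₀ + + r * y₁) (rank-without-greatest R (≺-greatest R R-witness) Ra a≢m)

permutation-key-injective : ∀ {n} (π : Permutation′ n) {a b} → toℕ (π ⟨$⟩ʳ a) ≡ toℕ (π ⟨$⟩ʳ b) → a ≡ b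
permutation-key-injective π e =
  trans (sym (inverseˡ π)) (trans (cong (π ⟨$⟩ˡ_) (FinP.toℕ-injective e)) (inverseˡ π))

module PermutationOrder {n : ℕ} (π : Permutation′ n) =
  KeyOrder (λ a → toℕ (π ⟨$⟩ʳ a)) (permutation-key-injective π)

_≗ᴱ_ : ∀ {n Γ} → REnv n Γ → REnv n Γ → Set
ρ ≗ᴱ ρ′ = ∀ k x t → ρ k x t ≡ ρ′ k x t

extEnv-cong : ∀ {n k Γ} {R : Rel n k} {ρ ρ′ : REnv n Γ} → ρ ≗ᴱ ρ′ → extEnv R ρ ≗ᴱ extEnv R ρ′
extEnv-cong e _ here      t = refl
extEnv-cong e k (there x) t = e k x t

eval-cong : ∀ {o m Γ} (G : Graph) ord (v : Fin m → Fin (size G)) {ρ ρ′ : REnv (size G) Γ} →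
  ρ ≗ᴱ ρ′ → (φ : Formula o m Γ) → eval G ord v ρ φ ≡ eval G ord v ρ′ φ
eval-cong G ord v e (edge a b)     = refl
eval-cong G ord v e (equal a b)    = refl
eval-cong G ord v e (less _ a b)   = refl
eval-cong G ord v e (rel {k} x as) = e k x _
eval-cong G ord v e (neg φ)        = cong not (eval-cong G ord v e φ)
eval-cong G ord v e (conj φ ψ)     = cong₂ _∧_ (eval-cong G ord v e φ) (eval-cong G ord v e ψ)
eval-cong G ord v e (disj φ ψ)     = cong₂ _∨_ (eval-cong G ord v e φ) (eval-cong G ord v e ψ)
eval-cong G ord v e (ex₁ φ)        = any-cong (λ a → eval-cong G ord (extVal a v) e φ) (allFin (size G))
eval-cong G ord v e (all₁ φ)       = all-cong (λ a → eval-cong G ord (extVal a v) e φ) (allFin (size G))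
eval-cong G ord v e (ex₂ k φ)      = any-cong (λ R → eval-cong G ord v (extEnv-cong e) φ) (allRels (size G) k)
eval-cong G ord v e (all₂ k φ)     = all-cong (λ R → eval-cong G ord v (extEnv-cong e) φ) (allRels (size G) k)

module _ {A B : Set} (_~_ : B → A → Set) {p : B → Bool} {q : A → Bool}
         (resp : ∀ {b a} → b ~ a → p b ≡ q a) (xs : List B) (ys : List A)
         (left-total : ∀ {b} → b ∈ xs → ∃ λ a → a ∈ ys × b ~ a) where

  any-transfer : (∀ {a} → a ∈ ys → q a ≡ true → ∃ λ b → b ∈ xs × b ~ a) → any p xs ≡ any q ys
  any-transfer right-total = bool-ext to from
    where
    to : any p xs ≡ true → any q ys ≡ true
    to e = let (b , b∈ , pb) = any-elim xs e
               (a , a∈ , b~a) = left-total b∈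
           in any-intro ys a∈ (trans (sym (resp b~a)) pb)
    from : any q ys ≡ true → any p xs ≡ true
    from e = let (a , a∈ , qa) = any-elim ys e
                 (b , b∈ , b~a) = right-total a∈ qa
             in any-intro xs b∈ (trans (resp b~a) qa)

  all-transfer : (∀ {a} → a ∈ ys → q a ≡ false → ∃ λ b → b ∈ xs × b ~ a) → all p xs ≡ all q ys
  all-transfer right-total = bool-ext to from
    where
    to : all p xs ≡ true → all q ys ≡ true
    to e = all-intro ys λ a a∈ → helper a a∈ (q a) refl
      where
      helper : ∀ a → a ∈ ys → ∀ c → q a ≡ c → q a ≡ true
      helper a a∈ true  qa = qa
      helper a a∈ false qa = let (b , b∈ , b~a) = right-total a∈ qa
                             in ⊥-elim (true≢false (trans (sym (all-elim xs e b∈)) (trans (resp b~a) qa)))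
    from : all q ys ≡ true → all p xs ≡ true
    from e = all-intro xs λ b b∈ → let (a , a∈ , b~a) = left-total b∈ in trans (resp b~a) (all-elim ys e a∈)

liftˡ : ∀ {Γ Δ k} → Γ ∋ k → (Γ ++ Δ) ∋ k
liftˡ here      = here
liftˡ (there x) = there (liftˡ x)

liftʳ : ∀ Γ {Δ k} → Δ ∋ k → (Γ ++ Δ) ∋ k
liftʳ []      x = x
liftʳ (l ∷ Γ) x = there (liftʳ Γ x)

not∨-false : ∀ {a b} → (not a ∨ b) ≡ false → a ≡ true
not∨-false {true} _ = refl

-- Relativisation to the class {w | E r w}, where E is a binary second-order variable listed
-- after Γ and r is a new last first-order variable.
module Relativisation {Δ : List ℕ} (E∈Δ : Δ ∋ 2) where

  inClass : ∀ {m} Γ → Fin (m ℕ.+ 1) → Formula true (m ℕ.+ 1) (Γ ++ Δ)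
  inClass {m} Γ x = rel (liftʳ Γ E∈Δ) ((m Fin.↑ʳ Fin.zero) ∷ x ∷ [])

  relativise : ∀ {m Γ} → Formula false m Γ → Formula true (m ℕ.+ 1) (Γ ++ Δ)
  relativise (edge a b)  = edge (a Fin.↑ˡ 1) (b Fin.↑ˡ 1)
  relativise (equal a b) = equal (a Fin.↑ˡ 1) (b Fin.↑ˡ 1)
  relativise (less () a b)
  relativise (rel x as)  = rel (liftˡ x) (Vec.map (Fin._↑ˡ 1) as)
  relativise (neg φ)     = neg (relativise φ)
  relativise (conj φ ψ)  = conj (relativise φ) (relativise ψ)
  relativise (disj φ ψ)  = disj (relativise φ) (relativise ψ)
  relativise {m} {Γ} (ex₁ φ)  = ex₁ (conj (inClass {suc m} Γ Fin.zero) (relativise φ))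
  relativise {m} {Γ} (all₁ φ) = all₁ (disj (neg (inClass {suc m} Γ Fin.zero)) (relativise φ))
  relativise (ex₂ k φ)   = ex₂ k (relativise φ)
  relativise (all₂ k φ)  = all₂ k (relativise φ)

  module _ (G : Graph) (vs : List (Fin (size G))) (vs-unique : Unique vs) where

    private
      H = induced G vs
      N = size G

      lk : Fin (length vs) → Fin N
      lk = List.lookup vs

      lk-injective : ∀ {a b} → lk a ≡ lk b → a ≡ b
      lk-injective = lookup-injective vs-unique

      map-lk-injective : ∀ {k} {s s′ : Vec (Fin (length vs)) k} → Vec.map lk s ≡ Vec.map lk s′ → s ≡ s′
      map-lk-injective {s = []}    {[]}     e = refl
      map-lk-injective {s = a ∷ s} {b ∷ s′} e =
        cong₂ _∷_ (lk-injective (VecP.∷-injectiveˡ e)) (map-lk-injective (VecP.∷-injectiveʳ e))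

      =ᶠ-lk : ∀ a b → (lk a =ᶠ lk b) ≡ (a =ᶠ b)
      =ᶠ-lk a b = bool-ext (λ e → subst (λ z → (a =ᶠ z) ≡ true) (lk-injective (=ᶠ⇒≡ e)) (=ᶠ-refl a))
                           (λ e → subst (λ z → (lk a =ᶠ lk z) ≡ true) (=ᶠ⇒≡ e) (=ᶠ-refl (lk a)))

      image : ∀ {k} → Rel (length vs) k → Rel N k
      image {k} R′ t = any (λ s → (Vec.map lk s =ᵛ t) ∧ R′ s) (allTuples (length vs) k)

      image-correct : ∀ {k} (R′ : Rel (length vs) k) s → R′ s ≡ image R′ (Vec.map lk s)
      image-correct {k} R′ s = bool-ext
        (λ e → any-intro (allTuples (length vs) k) (∈-allTuples s) (∧-intro (=ᵛ-refl (Vec.map lk s)) e))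
        (λ e → let (s′ , _ , q) = any-elim (allTuples (length vs) k) e
               in subst (λ z → R′ z ≡ true) (map-lk-injective (=ᵛ⇒≡ (∧-elimˡ q))) (∧-elimʳ _ q))

      _~ᴿ_ : ∀ {k} → Rel (length vs) k → Rel N k → Set
      R′ ~ᴿ R = ∀ s → R′ s ≡ R (Vec.map lk s)

      restrictions-exist : ∀ {k} {R′} → R′ ∈ allRels (length vs) k → ∃ λ R → R ∈ allRels N k × R′ ~ᴿ R
      restrictions-exist {k} {R′} _ =
        let (R , R∈ , R≗) = allRels-complete (image R′)
        in R , R∈ , λ s → trans (image-correct R′ s) (sym (R≗ (Vec.map lk s)))

      extensions-exist : ∀ {k} {R} → R ∈ allRels N k → ∃ λ R′ → R′ ∈ allRels (length vs) k × R′ ~ᴿ R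
      extensions-exist {k} {R} _ = let (R′ , R′∈ , R′≗) = allRels-complete (R ∘ Vec.map lk) in R′ , R′∈ , R′≗

      index-of : ∀ {w} → w ∈ vs → ∃ λ a → lk a ≡ w
      index-of w∈ = Any.index w∈ , sym (AnyP.lookup-index w∈)

    relativise-correct : ∀ {m Γ} (φ : Formula false m Γ) ord ord′
      (v′ : Fin m → Fin (length vs)) (v : Fin (m ℕ.+ 1) → Fin N)
      (ρ′ : REnv (length vs) Γ) (ρ : REnv N (Γ ++ Δ)) →
      (∀ i → v (i Fin.↑ˡ 1) ≡ lk (v′ i)) →
      (∀ k (x : Γ ∋ k) s → ρ′ k x s ≡ ρ k (liftˡ x) (Vec.map lk s)) →
      (∀ w → ρ 2 (liftʳ Γ E∈Δ) (v (m Fin.↑ʳ Fin.zero) ∷ w ∷ []) ≡ true → w ∈ vs) →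
      (∀ w → w ∈ vs → ρ 2 (liftʳ Γ E∈Δ) (v (m Fin.↑ʳ Fin.zero) ∷ w ∷ []) ≡ true) →
      eval H ord′ v′ ρ′ φ ≡ eval G ord v ρ (relativise φ)
    relativise-correct (edge a b) ord ord′ v′ v ρ′ ρ hv hρ g⇒∈ ∈⇒g rewrite hv a | hv b = refl
    relativise-correct (equal a b) ord ord′ v′ v ρ′ ρ hv hρ g⇒∈ ∈⇒g rewrite hv a | hv b = sym (=ᶠ-lk (v′ a) (v′ b))
    relativise-correct (less () a b) ord ord′ v′ v ρ′ ρ hv hρ g⇒∈ ∈⇒g
    relativise-correct (rel {k} x as) ord ord′ v′ v ρ′ ρ hv hρ g⇒∈ ∈⇒g =
      trans (hρ k x (Vec.map v′ as))
            (cong (ρ k (liftˡ x)) (trans (sym (VecP.map-∘ lk v′ as))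
                                  (trans (VecP.map-cong (λ i → sym (hv i)) as) (VecP.map-∘ v (Fin._↑ˡ 1) as))))
    relativise-correct (neg φ) ord ord′ v′ v ρ′ ρ hv hρ g⇒∈ ∈⇒g =
      cong not (relativise-correct φ ord ord′ v′ v ρ′ ρ hv hρ g⇒∈ ∈⇒g)
    relativise-correct (conj φ ψ) ord ord′ v′ v ρ′ ρ hv hρ g⇒∈ ∈⇒g =
      cong₂ _∧_ (relativise-correct φ ord ord′ v′ v ρ′ ρ hv hρ g⇒∈ ∈⇒g) (relativise-correct ψ ord ord′ v′ v ρ′ ρ hv hρ g⇒∈ ∈⇒g)
    relativise-correct (disj φ ψ) ord ord′ v′ v ρ′ ρ hv hρ g⇒∈ ∈⇒g =
      cong₂ _∨_ (relativise-correct φ ord ord′ v′ v ρ′ ρ hv hρ g⇒∈ ∈⇒g) (relativise-correct ψ ord ord′ v′ v ρ′ ρ hv hρ g⇒∈ ∈⇒g)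
    relativise-correct {m} {Γ} (ex₁ φ) ord ord′ v′ v ρ′ ρ hv hρ g⇒∈ ∈⇒g =
      any-transfer (λ a w → lk a ≡ w) (λ { {a} refl → trans (at a) (sym (cong (_∧ eval G ord (extVal (lk a) v) ρ (relativise φ)) (guard a))) })
        (allFin (length vs)) (allFin N) (λ {a} _ → lk a , ∈P.∈-allFin (lk a) , refl)
        (λ {w} _ e → let (a , lka≡w) = index-of (g⇒∈ w (∧-elimˡ e)) in a , ∈P.∈-allFin a , lka≡w)
      where
      at : ∀ a → eval H ord′ (extVal a v′) ρ′ φ ≡ eval G ord (extVal (lk a) v) ρ (relativise φ)
      at a = relativise-correct φ ord ord′ (extVal a v′) (extVal (lk a) v) ρ′ ρ
               (λ { Fin.zero → refl ; (Fin.suc i) → hv i }) hρ g⇒∈ ∈⇒g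
      guard : ∀ a → ρ 2 (liftʳ Γ E∈Δ) (v (m Fin.↑ʳ Fin.zero) ∷ lk a ∷ []) ≡ true
      guard a = ∈⇒g (lk a) (∈P.∈-lookup a)
    relativise-correct {m} {Γ} (all₁ φ) ord ord′ v′ v ρ′ ρ hv hρ g⇒∈ ∈⇒g =
      all-transfer (λ a w → lk a ≡ w) (λ { {a} refl → trans (at a) (sym (cong (λ b → not b ∨ eval G ord (extVal (lk a) v) ρ (relativise φ)) (guard a))) })
        (allFin (length vs)) (allFin N) (λ {a} _ → lk a , ∈P.∈-allFin (lk a) , refl)
        (λ {w} _ e → let (a , lka≡w) = index-of (g⇒∈ w (not∨-false e)) in a , ∈P.∈-allFin a , lka≡w)
      where
      at : ∀ a → eval H ord′ (extVal a v′) ρ′ φ ≡ eval G ord (extVal (lk a) v) ρ (relativise φ)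
      at a = relativise-correct φ ord ord′ (extVal a v′) (extVal (lk a) v) ρ′ ρ
               (λ { Fin.zero → refl ; (Fin.suc i) → hv i }) hρ g⇒∈ ∈⇒g
      guard : ∀ a → ρ 2 (liftʳ Γ E∈Δ) (v (m Fin.↑ʳ Fin.zero) ∷ lk a ∷ []) ≡ true
      guard a = ∈⇒g (lk a) (∈P.∈-lookup a)
    relativise-correct (ex₂ k φ) ord ord′ v′ v ρ′ ρ hv hρ g⇒∈ ∈⇒g =
      any-transfer _~ᴿ_ (λ {R′} {R} R′~R → at R′ R R′~R) (allRels (length vs) k) (allRels N k)
        restrictions-exist (λ R∈ _ → extensions-exist R∈)
      where
      at : ∀ R′ R → R′ ~ᴿ R → eval H ord′ v′ (extEnv R′ ρ′) φ ≡ eval G ord v (extEnv R ρ) (relativise φ)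
      at R′ R R′~R = relativise-correct φ ord ord′ v′ v (extEnv R′ ρ′) (extEnv R ρ) hv
                       (λ { _ here s → R′~R s ; k′ (there x) s → hρ k′ x s }) g⇒∈ ∈⇒g
    relativise-correct (all₂ k φ) ord ord′ v′ v ρ′ ρ hv hρ g⇒∈ ∈⇒g =
      all-transfer _~ᴿ_ (λ {R′} {R} R′~R → at R′ R R′~R) (allRels (length vs) k) (allRels N k)
        restrictions-exist (λ R∈ _ → extensions-exist R∈)
      where
      at : ∀ R′ R → R′ ~ᴿ R → eval H ord′ v′ (extEnv R′ ρ′) φ ≡ eval G ord v (extEnv R ρ) (relativise φ)
      at R′ R R′~R = relativise-correct φ ord ord′ v′ v (extEnv R′ ρ′) (extEnv R ρ) hv
                       (λ { _ here s → R′~R s ; k′ (there x) s → hρ k′ x s }) g⇒∈ ∈⇒g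

∑-allRels-reindex : ∀ {n k} {B : Set} (F : Rel n k → ℤ) (g : B → Rel n k) (ys : List B) →
  (∀ {R Q} → (R ≐ Q) ≡ true → F R ≡ F Q) →
  (∀ R → F R ≡ + 0 ⊎ ∑ (λ b → 𝟙 (R ≐ g b)) ys ≡ + 1) →
  ∑ F (allRels n k) ≡ ∑ (F ∘ g) ys
∑-allRels-reindex {n} {k} F g ys F-resp one-preimage =
  ∑-double-count (allRels n k) ys F (F ∘ g) (λ R b → R ≐ g b) unique-partner fibre
  where
  unique-partner : ∀ R → F R * ∑ (λ b → 𝟙 (R ≐ g b)) ys ≡ F R
  unique-partner R with one-preimage R
  ... | inj₁ FR≡0 rewrite FR≡0 = ℤP.*-zeroˡ (∑ (λ b → 𝟙 (R ≐ g b)) ys)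
  ... | inj₂ #≡1  rewrite #≡1  = ℤP.*-identityʳ (F R)
  fibre : ∀ b → F (g b) ≡ ∑ (λ R → if R ≐ g b then F R else + 0) (allRels n k)
  fibre b = sym (begin
      ∑ (λ R → if R ≐ g b then F R else + 0) (allRels n k)
    ≡⟨ ∑-cong (λ R → on-fibre (R ≐ g b) F-resp) (allRels n k) ⟩
      ∑ (λ R → if R ≐ g b then F (g b) else + 0) (allRels n k)
    ≡⟨ ∑-if-const (_≐ g b) (F (g b)) (allRels n k) ⟩
      F (g b) * ∑ (λ R → 𝟙 (R ≐ g b)) (allRels n k)
    ≡⟨ cong (F (g b) *_) (∑-allRels-≐ (g b)) ⟩
      F (g b) * + 1
    ≡⟨ ℤP.*-identityʳ _ ⟩
      F (g b) ∎)
    where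
    open ≡-Reasoning
    on-fibre : ∀ c {u v} → (c ≡ true → u ≡ v) → (if c then u else + 0) ≡ (if c then v else + 0)
    on-fibre true  u≡v = u≡v refl
    on-fibre false u≡v = refl

-- The two second-order variables of the Harary expression: an equivalence relation E
-- whose classes are the blocks, and a relation C encoding a choice function.
Γ₀ : List ℕ
Γ₀ = 2 ∷ 2 ∷ []

E∈Γ₀ C∈Γ₀ : Γ₀ ∋ 2
E∈Γ₀ = here
C∈Γ₀ = there here

open Relativisation E∈Γ₀ using (relativise; relativise-correct)

v₀ : ∀ {m} → Fin (suc m)
v₀ = Fin.zero

v₁ : ∀ {m} → Fin (suc (suc m))
v₁ = Fin.suc Fin.zero

v₂ : ∀ {m} → Fin (suc (suc (suc m)))
v₂ = Fin.suc (Fin.suc Fin.zero)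

_⇒ᶠ_ : ∀ {m} → Formula true m Γ₀ → Formula true m Γ₀ → Formula true m Γ₀
φ ⇒ᶠ ψ = disj (neg φ) ψ

E⟨_,_⟩ C⟨_,_⟩ : ∀ {m} → Fin m → Fin m → Formula true m Γ₀
E⟨ a , b ⟩ = rel E∈Γ₀ (a ∷ b ∷ [])
C⟨ a , b ⟩ = rel C∈Γ₀ (a ∷ b ∷ [])

-- x is the ≺-least element of its E-class
leastF : ∀ {m} → Fin m → Formula true m Γ₀
leastF x = all₁ (E⟨ Fin.suc x , v₀ ⟩ ⇒ᶠ neg (less tt v₀ (Fin.suc x)))

-- a is an allowed value at b: a least element may point to itself or to an earlier
-- least element, any other element must point to itself
allowedF : ∀ {m} → Fin m → Fin m → Formula true m Γ₀
allowedF b a = disj (conj (leastF b) (disj (equal a b) (conj (leastF a) (less tt a b))))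
                    (conj (neg (leastF b)) (equal a b))

choiceF : Formula true 0 Γ₀
choiceF = all₁ (ex₁ (conj (conj C⟨ v₁ , v₀ ⟩ (allowedF v₁ v₀)) (all₁ (C⟨ v₂ , v₀ ⟩ ⇒ᶠ equal v₀ v₁))))

equivalenceF : Formula true 0 Γ₀
equivalenceF = conj (all₁ E⟨ v₀ , v₀ ⟩)
               (conj (all₁ (all₁ (E⟨ v₁ , v₀ ⟩ ⇒ᶠ E⟨ v₀ , v₁ ⟩)))
                     (all₁ (all₁ (all₁ (E⟨ v₂ , v₁ ⟩ ⇒ᶠ (E⟨ v₁ , v₀ ⟩ ⇒ᶠ E⟨ v₂ , v₀ ⟩))))))

hararyF : Sentence → Formula true 0 Γ₀
hararyF φ = conj (conj equivalenceF (all₁ (relativise φ))) choiceF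

-- x₀ counts the least elements fixed by C, x₁ the elements moved by C
hararyFactors : List (Factor 2 Γ₀)
hararyFactors = factor 1 (conj (leastF v₀) C⟨ v₀ , v₀ ⟩) Fin.zero
              ∷ factor 2 (conj C⟨ v₀ , v₁ ⟩ (neg (equal v₀ v₁))) (Fin.suc Fin.zero)
              ∷ []

hararyExpr : Sentence → PolyExpr 2
hararyExpr φ = basic Γ₀ (hararyF φ) hararyFactors

allVecs-1 : ∀ {A : Set} (xs : List A) → allVecs xs 1 ≡ map (_∷ []) xs
allVecs-1 []       = refl
allVecs-1 (x ∷ xs) = cong ((x ∷ []) ∷_) (allVecs-1 xs)

allVecs-2 : ∀ {A : Set} (xs : List A) → allVecs xs 2 ≡ concatMap (λ b → map (λ a → b ∷ a ∷ []) xs) xs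
allVecs-2 xs = ListP.concatMap-cong (λ b → trans (cong (map (b ∷_)) (allVecs-1 xs)) (sym (ListP.map-∘ xs))) xs

env : ∀ {n} → Rel n 2 → Rel n 2 → REnv n Γ₀
env E C = extEnv E (extEnv C emptyEnv)

graphOf : ∀ {n} → Vec (Fin n) n → Rel n 2
graphOf c (b ∷ a ∷ []) = Vec.lookup c b =ᶠ a

module Choices (G : Graph) (π : Permutation′ (size G)) (y : Fin 2 → ℤ) where

  open PermutationOrder π public

  n = size G
  y₀ = y Fin.zero
  y₁ = y (Fin.suc Fin.zero)

  weight : REnv n Γ₀ → ℤ
  weight ρ = productℤ (map (λ F → y (Factor.var F) ^
               length (filterᵇ (λ as → eval G _≺_ (λ i → Vec.lookup as i) ρ (Factor.cond F))
                               (allVecs (allFin n) (Factor.arity F))))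
             hararyFactors)

  weight-cong : ∀ {ρ ρ′} → ρ ≗ᴱ ρ′ → weight ρ ≡ weight ρ′
  weight-cong e = cong productℤ (ListP.map-cong (λ F → cong (λ l → y (Factor.var F) ^ length l)
                    (filterᵇ-cong (λ as → eval-cong G _≺_ (λ i → Vec.lookup as i) e (Factor.cond F))
                                  (allVecs (allFin n) (Factor.arity F)))) hararyFactors)

  module _ (E : Rel n 2) where

    isLeast : Fin n → Bool
    isLeast b = all (λ u → not (E (b ∷ u ∷ [])) ∨ not (u ≺ b)) (allFin n)

    allowed : Fin n → Fin n → Bool
    allowed b a = (isLeast b ∧ ((a =ᶠ b) ∨ (isLeast a ∧ a ≺ b))) ∨ (not (isLeast b) ∧ (a =ᶠ b))

    isChoice : Rel n 2 → Bool
    isChoice C = eval G _≺_ noVars (env E C) choiceF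

    choiceWeight : Fin n → Fin n → ℤ
    choiceWeight b a = (if isLeast b ∧ (a =ᶠ b) then y₀ else + 1) * (if not (b =ᶠ a) then y₁ else + 1)

    choiceTerm : Rel n 2 → ℤ
    choiceTerm C = if isChoice C then weight (env E C) else + 0

    isChoice-graphOf : ∀ c → isChoice (graphOf c) ≡ all (λ b → allowed b (Vec.lookup c b)) (allFin n)
    isChoice-graphOf c = all-cong (λ b → bool-ext (to b) (from b)) (allFin n)
      where
      to : ∀ b → any (λ a → ((Vec.lookup c b =ᶠ a) ∧ allowed b a) ∧
                             all (λ a′ → not (Vec.lookup c b =ᶠ a′) ∨ (a′ =ᶠ a)) (allFin n)) (allFin n) ≡ true
               → allowed b (Vec.lookup c b) ≡ true
      to b e = let (a , _ , q) = any-elim (allFin n) e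
               in subst (λ z → allowed b z ≡ true) (sym (=ᶠ⇒≡ (∧-elimˡ (∧-elimˡ q)))) (∧-elimʳ (Vec.lookup c b =ᶠ a) (∧-elimˡ q))
      from : ∀ b → allowed b (Vec.lookup c b) ≡ true →
             any (λ a → ((Vec.lookup c b =ᶠ a) ∧ allowed b a) ∧
                        all (λ a′ → not (Vec.lookup c b =ᶠ a′) ∨ (a′ =ᶠ a)) (allFin n)) (allFin n) ≡ true
      from b e = any-intro (allFin n) (∈P.∈-allFin (Vec.lookup c b))
        (∧-intro (∧-intro (=ᶠ-refl (Vec.lookup c b)) e) (all-intro (allFin n) λ a′ _ → unique a′))
        where
        unique : ∀ a′ → (not (Vec.lookup c b =ᶠ a′) ∨ (a′ =ᶠ Vec.lookup c b)) ≡ true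
        unique a′ with Vec.lookup c b =ᶠ a′ in e′
        ... | true  = subst (λ z → (a′ =ᶠ z) ≡ true) (sym (=ᶠ⇒≡ e′)) (=ᶠ-refl a′)
        ... | false = refl

    weight-graphOf : ∀ c → weight (env E (graphOf c)) ≡ ∏ (λ b → choiceWeight b (Vec.lookup c b)) (allFin n)
    weight-graphOf c = begin
        y₀ ^ length (filterᵇ fixed (allVecs (allFin n) 1)) * (y₁ ^ length (filterᵇ moved (allVecs (allFin n) 2)) * + 1)
      ≡⟨ cong₂ _*_ fixed-part (trans (ℤP.*-identityʳ _) moved-part) ⟩
        ∏ w₀ (allFin n) * ∏ w₁ (allFin n)
      ≡⟨ sym (∏-* w₀ w₁ (allFin n)) ⟩
        ∏ (λ b → choiceWeight b (Vec.lookup c b)) (allFin n) ∎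
      where
      open ≡-Reasoning
      lk = Vec.lookup
      fixed : Vec (Fin n) 1 → Bool
      fixed as = isLeast (lk as v₀) ∧ graphOf c (lk as v₀ ∷ lk as v₀ ∷ [])
      moved : Vec (Fin n) 2 → Bool
      moved as = graphOf c (lk as v₀ ∷ lk as v₁ ∷ []) ∧ not (lk as v₀ =ᶠ lk as v₁)
      w₀ w₁ : Fin n → ℤ
      w₀ b = if isLeast b ∧ (lk c b =ᶠ b) then y₀ else + 1
      w₁ b = if not (b =ᶠ lk c b) then y₁ else + 1
      fixed-part : y₀ ^ length (filterᵇ fixed (allVecs (allFin n) 1)) ≡ ∏ w₀ (allFin n)
      fixed-part = trans (^-length-filterᵇ y₀ fixed (allVecs (allFin n) 1))
                   (trans (cong (∏ (λ as → if fixed as then y₀ else + 1)) (allVecs-1 (allFin n)))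
                          (∏-map (λ as → if fixed as then y₀ else + 1) (_∷ []) (allFin n)))
      only-c-b : ∀ b a → (if (lk c b =ᶠ a) ∧ not (b =ᶠ a) then y₁ else + 1)
                       ≡ (if lk c b =ᶠ a then (if not (b =ᶠ a) then y₁ else + 1) else + 1)
      only-c-b b a with lk c b =ᶠ a
      ... | true  = refl
      ... | false = refl
      moved-part : y₁ ^ length (filterᵇ moved (allVecs (allFin n) 2)) ≡ ∏ w₁ (allFin n)
      moved-part = begin
          y₁ ^ length (filterᵇ moved (allVecs (allFin n) 2))
        ≡⟨ ^-length-filterᵇ y₁ moved (allVecs (allFin n) 2) ⟩
          ∏ W (allVecs (allFin n) 2)
        ≡⟨ cong (∏ W) (allVecs-2 (allFin n)) ⟩
          ∏ W (concatMap (λ b → map (λ a → b ∷ a ∷ []) (allFin n)) (allFin n))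
        ≡⟨ ∏-concatMap W (λ b → map (λ a → b ∷ a ∷ []) (allFin n)) (allFin n) ⟩
          ∏ (λ b → ∏ W (map (λ a → b ∷ a ∷ []) (allFin n))) (allFin n)
        ≡⟨ ∏-cong (λ b → trans (∏-map W (λ a → b ∷ a ∷ []) (allFin n))
                         (trans (∏-cong (only-c-b b) (allFin n))
                                (∏-single Fin._≟_ (UniqueP.allFin⁺ n) (∈P.∈-allFin (lk c b))
                                          (λ a → if not (b =ᶠ a) then y₁ else + 1)))) (allFin n) ⟩
          ∏ w₁ (allFin n) ∎
        where
        W : Vec (Fin n) 2 → ℤ
        W as = if moved as then y₁ else + 1

    choiceTerm-graphOf : ∀ c → choiceTerm (graphOf c) ≡ ∏ᶠ n (λ b → if allowed b (Vec.lookup c b) then choiceWeight b (Vec.lookup c b) else + 0)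
    choiceTerm-graphOf c = begin
        (if isChoice (graphOf c) then weight (env E (graphOf c)) else + 0)
      ≡⟨ cong₂ (λ b v → if b then v else + 0) (isChoice-graphOf c) (weight-graphOf c) ⟩
        (if all (λ b → allowed b (Vec.lookup c b)) (allFin n) then ∏ (λ b → choiceWeight b (Vec.lookup c b)) (allFin n) else + 0)
      ≡⟨ if-all≡∏ _ _ (allFin n) ⟩
        ∏ (λ b → if allowed b (Vec.lookup c b) then choiceWeight b (Vec.lookup c b) else + 0) (allFin n)
      ≡⟨ ∏-allFin n _ ⟩
        _ ∎
      where open ≡-Reasoning

    row-sum : ∀ b → ∑ (λ a → if allowed b a then choiceWeight b a else + 0) (allFin n) ≡ rankFactor y₀ y₁ isLeast b
    row-sum b = by-leastness (isLeast b) refl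
      where
      by-leastness : ∀ r → isLeast b ≡ r →
        ∑ (λ a → if allowed b a then choiceWeight b a else + 0) (allFin n) ≡ (if r then y₀ + + rank isLeast b * y₁ else + 1)
      by-leastness true least-b = begin
          ∑ (λ a → if allowed b a then choiceWeight b a else + 0) (allFin n)
        ≡⟨ ∑-cong split (allFin n) ⟩
          ∑ (λ a → (if b =ᶠ a then y₀ else + 0) + (if isLeast a ∧ a ≺ b then y₁ else + 0)) (allFin n)
        ≡⟨ ∑-+ (λ a → if b =ᶠ a then y₀ else + 0) (λ a → if isLeast a ∧ a ≺ b then y₁ else + 0) (allFin n) ⟩
          ∑ (λ a → if b =ᶠ a then y₀ else + 0) (allFin n) + ∑ (λ a → if isLeast a ∧ a ≺ b then y₁ else + 0) (allFin n)
        ≡⟨ cong₂ _+_ (∑-single Fin._≟_ (UniqueP.allFin⁺ n) (∈P.∈-allFin b) (λ _ → y₀))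
                     (trans (∑-if-const (λ a → isLeast a ∧ a ≺ b) y₁ (allFin n))
                            (trans (cong (y₁ *_) (sym (length-filterᵇ (λ a → isLeast a ∧ a ≺ b) (allFin n))))
                                   (ℤP.*-comm y₁ _))) ⟩
          y₀ + + rank isLeast b * y₁ ∎
        where
        open ≡-Reasoning
        split : ∀ a → (if allowed b a then choiceWeight b a else + 0)
                      ≡ (if b =ᶠ a then y₀ else + 0) + (if isLeast a ∧ a ≺ b then y₁ else + 0)
        split a rewrite least-b | =ᶠ-sym b a with a =ᶠ b in a=b
        ... | true rewrite trans (cong (a ≺_) (sym (=ᶠ⇒≡ a=b))) (≺-irrefl a) | BoolP.∧-zeroʳ (isLeast a) =
              trans (ℤP.*-identityʳ y₀) (sym (ℤP.+-identityʳ y₀))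
        ... | false rewrite BoolP.∨-identityʳ (isLeast a ∧ a ≺ b) with isLeast a ∧ a ≺ b
        ...   | true  = trans (ℤP.*-identityˡ y₁) (sym (ℤP.+-identityˡ y₁))
        ...   | false = refl
      by-leastness false least-b = trans (∑-cong fixed (allFin n)) (∑-single Fin._≟_ (UniqueP.allFin⁺ n) (∈P.∈-allFin b) (λ _ → + 1))
        where
        fixed : ∀ a → (if allowed b a then choiceWeight b a else + 0) ≡ (if b =ᶠ a then + 1 else + 0)
        fixed a rewrite least-b | =ᶠ-sym b a with a =ᶠ b
        ... | true  = refl
        ... | false = refl

    rowIs : Rel n 2 → Fin n → Fin n → Bool
    rowIs C b a = all (λ a′ → C (b ∷ a′ ∷ []) == (a =ᶠ a′)) (allFin n)

    ≐-graphOf : ∀ C c → (C ≐ graphOf c) ≡ all (λ b → rowIs C b (Vec.lookup c b)) (allFin n)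
    ≐-graphOf C c = trans (cong (all p) (allVecs-2 (allFin n)))
                    (trans (all-concatMap p (λ b → map (λ a → b ∷ a ∷ []) (allFin n)) (allFin n))
                           (all-cong (λ b → all-map p (λ a → b ∷ a ∷ []) (allFin n)) (allFin n)))
      where
      p : Vec (Fin n) 2 → Bool
      p t = C t == graphOf c t

    rowIs-unique : ∀ C → isChoice C ≡ true → ∀ b → ∑ (λ a → 𝟙 (rowIs C b a)) (allFin n) ≡ + 1
    rowIs-unique C choice b =
      trans (∑-cong (λ a → cong 𝟙 (rowIs≡ a)) (allFin n)) (∑-single Fin._≟_ (UniqueP.allFin⁺ n) (∈P.∈-allFin a₀) (λ _ → + 1))
      where
      some-a = any-elim (allFin n) (all-elim (allFin n) choice (∈P.∈-allFin b))
      a₀ = proj₁ some-a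
      Cba₀ : C (b ∷ a₀ ∷ []) ≡ true
      Cba₀ = ∧-elimˡ (∧-elimˡ (proj₂ (proj₂ some-a)))
      only-a₀ : all (λ a′ → not (C (b ∷ a′ ∷ [])) ∨ (a′ =ᶠ a₀)) (allFin n) ≡ true
      only-a₀ = ∧-elimʳ (C (b ∷ a₀ ∷ []) ∧ allowed b a₀) (proj₂ (proj₂ some-a))
      rowIs-a₀ : rowIs C b a₀ ≡ true
      rowIs-a₀ = all-intro (allFin n) λ a′ _ → at a′
        where
        at : ∀ a′ → (C (b ∷ a′ ∷ []) == (a₀ =ᶠ a′)) ≡ true
        at a′ with a₀ =ᶠ a′ in a₀=a′
        ... | true  = trans (==-true (C (b ∷ a′ ∷ []))) (subst (λ z → C (b ∷ z ∷ []) ≡ true) (=ᶠ⇒≡ a₀=a′) Cba₀)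
          where
          ==-true : ∀ x → (x == true) ≡ x
          ==-true true  = refl
          ==-true false = refl
        ... | false = ==-false (C (b ∷ a′ ∷ [])) (not-true⇒false (trans (sym (BoolP.∨-identityʳ _))
                        (subst (λ z → (not (C (b ∷ a′ ∷ [])) ∨ z) ≡ true) (trans (=ᶠ-sym a′ a₀) a₀=a′)
                               (all-elim (allFin n) only-a₀ (∈P.∈-allFin a′)))))
          where
          ==-false : ∀ x → x ≡ false → (x == false) ≡ true
          ==-false false _ = refl
      rowIs≡ : ∀ a → rowIs C b a ≡ (a₀ =ᶠ a)
      rowIs≡ a = bool-ext
        (λ e → trans (=ᶠ-sym a₀ a) (subst (λ z → (z == (a =ᶠ a₀)) ≡ true) Cba₀ (all-elim (allFin n) e (∈P.∈-allFin a₀))))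
        (λ e → subst (λ z → rowIs C b z ≡ true) (=ᶠ⇒≡ e) rowIs-a₀)

    choice-one-preimage : ∀ C → choiceTerm C ≡ + 0 ⊎ ∑ (λ c → 𝟙 (C ≐ graphOf c)) (allVecs (allFin n) n) ≡ + 1
    choice-one-preimage C with isChoice C in choice
    ... | false = inj₁ refl
    ... | true  = inj₂ (begin
        ∑ (λ c → 𝟙 (C ≐ graphOf c)) (allVecs (allFin n) n)
      ≡⟨ ∑-cong (λ c → trans (cong 𝟙 (≐-graphOf C c))
                      (trans (𝟙-all (λ b → rowIs C b (Vec.lookup c b)) (allFin n)) (∏-allFin n _))) (allVecs (allFin n) n) ⟩
        ∑ (λ c → ∏ᶠ n (λ b → 𝟙 (rowIs C b (Vec.lookup c b)))) (allVecs (allFin n) n)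
      ≡⟨ ∑-allVecs-∏ᶠ (allFin n) n (λ b a → 𝟙 (rowIs C b a)) ⟩
        ∏ᶠ n (λ b → ∑ (λ a → 𝟙 (rowIs C b a)) (allFin n))
      ≡⟨ ∏ᶠ-ones n (rowIs-unique C choice) ⟩
        + 1 ∎)
      where open ≡-Reasoning

    choiceTerm-resp : ∀ {C Q} → (C ≐ Q) ≡ true → choiceTerm C ≡ choiceTerm Q
    choiceTerm-resp {C} {Q} C≐Q = cong₂ (λ b v → if b then v else + 0) (eval-cong G _≺_ noVars same choiceF) (weight-cong same)
      where
      same : env E C ≗ᴱ env E Q
      same _ here         t = refl
      same _ (there here) t = ≐⇒≗ {R = C} {Q} C≐Q t

    ∑-choices : ∑ choiceTerm (allRels n 2) ≡ fallingBy y₀ y₁ (count isLeast (allFin n))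
    ∑-choices = begin
        ∑ choiceTerm (allRels n 2)
      ≡⟨ ∑-allRels-reindex choiceTerm graphOf (allVecs (allFin n) n) (λ {C} {Q} → choiceTerm-resp {C} {Q}) choice-one-preimage ⟩
        ∑ (choiceTerm ∘ graphOf) (allVecs (allFin n) n)
      ≡⟨ ∑-cong choiceTerm-graphOf (allVecs (allFin n) n) ⟩
        ∑ (λ c → ∏ᶠ n (λ b → if allowed b (Vec.lookup c b) then choiceWeight b (Vec.lookup c b) else + 0)) (allVecs (allFin n) n)
      ≡⟨ ∑-allVecs-∏ᶠ (allFin n) n (λ b a → if allowed b a then choiceWeight b a else + 0) ⟩
        ∏ᶠ n (λ b → ∑ (λ a → if allowed b a then choiceWeight b a else + 0) (allFin n))
      ≡⟨ ∏ᶠ-cong n row-sum ⟩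
        ∏ᶠ n (rankFactor y₀ y₁ isLeast)
      ≡⟨ sym (∏-allFin n (rankFactor y₀ y₁ isLeast)) ⟩
        ∏ (rankFactor y₀ y₁ isLeast) (allFin n)
      ≡⟨ ∏-rankFactor y₀ y₁ _ isLeast refl ⟩
        fallingBy y₀ y₁ (count isLeast (allFin n)) ∎
      where open ≡-Reasoning

module _ {n i : ℕ} (f : Vec (Fin i) n) (canonical : isCanonicalPartition f ≡ true) where

  private
    lk = Vec.lookup f

  canonical-surjective : ∀ b → ∃ λ v → lk v ≡ b
  canonical-surjective b =
    let (v , _ , fv=b) = any-elim (allFin n) (all-elim (allFin i) (∧-elimˡ canonical) (∈P.∈-allFin b))
    in v , =ᶠ⇒≡ fv=b

  canonical-growth : ∀ v (b : Fin i) → toℕ b ℕ.< toℕ (lk v) → ∃ λ u → toℕ u ℕ.< toℕ v × lk u ≡ b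
  canonical-growth v b b<fv =
    let at-v-b = all-elim (allFin i) (all-elim (allFin n) (∧-elimʳ surjective canonical) (∈P.∈-allFin v)) (∈P.∈-allFin b)
        (u , _ , q) = any-elim (allFin n) (subst (λ z → (not z ∨ earlier) ≡ true) (<⇒<ᵇ b<fv) at-v-b)
    in u , <ᵇ⇒< (∧-elimˡ q) , =ᶠ⇒≡ (∧-elimʳ (toℕ u <ᵇ toℕ v) q)
    where
    surjective = all (λ b → any (λ v → lk v =ᶠ b) (allFin n)) (allFin i)
    earlier = any (λ u → (toℕ u <ᵇ toℕ v) ∧ (lk u =ᶠ b)) (allFin n)

SameKernel : ∀ {n i j} → Vec (Fin i) n → Vec (Fin j) n → Set
SameKernel f g = ∀ u w → Vec.lookup f u ≡ Vec.lookup f w → Vec.lookup g u ≡ Vec.lookup g w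

-- A canonical labelling is determined by its kernel: by induction along the vertices,
-- a smaller label at v would have to be used already before v.
module _ {n i j : ℕ} (f : Vec (Fin i) n) (g : Vec (Fin j) n)
         (f-canonical : isCanonicalPartition f ≡ true) (g-canonical : isCanonicalPartition g ≡ true)
         (f⇒g : SameKernel f g) (g⇒f : SameKernel g f) where

  private
    not-below : ∀ {i′ j′} (f′ : Vec (Fin i′) n) (g′ : Vec (Fin j′) n) → isCanonicalPartition g′ ≡ true →
      SameKernel f′ g′ → ∀ v → (∀ u → toℕ u ℕ.< toℕ v → toℕ (Vec.lookup f′ u) ≡ toℕ (Vec.lookup g′ u)) →
      ¬ (toℕ (Vec.lookup f′ v) ℕ.< toℕ (Vec.lookup g′ v))
    not-below f′ g′ g′-canonical f′⇒g′ v agree-below f′v<g′v =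
      let f′v<j′ = ℕP.<-trans f′v<g′v (FinP.toℕ<n (Vec.lookup g′ v))
          b = Fin.fromℕ< f′v<j′
          toℕ-b = FinP.toℕ-fromℕ< f′v<j′
          (u , u<v , g′u≡b) = canonical-growth g′ g′-canonical v b (subst (ℕ._< _) (sym toℕ-b) f′v<g′v)
          g′u≡f′v = trans (cong toℕ g′u≡b) toℕ-b
          f′u≡f′v = FinP.toℕ-injective (trans (agree-below u u<v) g′u≡f′v)
      in ℕP.<-irrefl (trans (sym g′u≡f′v) (cong toℕ (f′⇒g′ u v f′u≡f′v))) f′v<g′v

    agree-below : ∀ k v → toℕ v ℕ.< k → toℕ (Vec.lookup f v) ≡ toℕ (Vec.lookup g v)
    agree-below (suc k) v v<1+k with ℕP.<-cmp (toℕ (Vec.lookup f v)) (toℕ (Vec.lookup g v))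
    ... | tri≈ _ eq _ = eq
    ... | tri< lt _ _ = ⊥-elim (not-below f g g-canonical f⇒g v (λ u u<v → agree-below k u (below u<v)) lt)
      where below = λ {u} (u<v : toℕ u ℕ.< toℕ v) → ℕP.<-≤-trans u<v (ℕP.≤-pred v<1+k)
    ... | tri> _ _ gt = ⊥-elim (not-below g f f-canonical g⇒f v (λ u u<v → sym (agree-below k u (below u<v))) gt)
      where below = λ {u} (u<v : toℕ u ℕ.< toℕ v) → ℕP.<-≤-trans u<v (ℕP.≤-pred v<1+k)

  canonical-labels-agree : ∀ v → toℕ (Vec.lookup f v) ≡ toℕ (Vec.lookup g v)
  canonical-labels-agree v = agree-below (suc (toℕ v)) v ℕP.≤-refl

  canonical-sizes-agree : i ≡ j
  canonical-sizes-agree with ℕP.<-cmp i j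
  ... | tri≈ _ eq _ = eq
  ... | tri< i<j _ _ = let (v , gv≡i) = canonical-surjective g g-canonical (Fin.fromℕ< i<j) in
    ⊥-elim (ℕP.<-irrefl (trans (canonical-labels-agree v) (trans (cong toℕ gv≡i) (FinP.toℕ-fromℕ< i<j)))
                        (FinP.toℕ<n (Vec.lookup f v)))
  ... | tri> _ _ j<i = let (v , fv≡j) = canonical-surjective f f-canonical (Fin.fromℕ< j<i) in
    ⊥-elim (ℕP.<-irrefl (trans (sym (canonical-labels-agree v)) (trans (cong toℕ fv≡j) (FinP.toℕ-fromℕ< j<i)))
                        (FinP.toℕ<n (Vec.lookup g v)))

discrete-ivt : (S : ℕ → ℕ) → S 0 ≡ 0 → (∀ k → S (suc k) ℕ.≤ suc (S k)) →
  ∀ K {b} → b ℕ.< S K → ∃ λ k → k ℕ.< K × S k ≡ b × S (suc k) ≡ suc b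
discrete-ivt S S0≡0 step zero    {b} b<S0 = ⊥-elim (ℕP.n≮0 (subst (b ℕ.<_) S0≡0 b<S0))
discrete-ivt S S0≡0 step (suc K) {b} b<S1+K with ℕP.<-cmp b (S K)
... | tri< b<SK _ _ = let (k , k<K , rest) = discrete-ivt S S0≡0 step K b<SK in k , ℕP.m<n⇒m<1+n k<K , rest
... | tri≈ _ b≡SK _ = K , ℕP.≤-refl , sym b≡SK ,
                      ℕP.≤-antisym (subst (λ z → S (suc K) ℕ.≤ suc z) (sym b≡SK) (step K)) b<S1+K
... | tri> _ _ SK<b = ⊥-elim (ℕP.<-irrefl refl (ℕP.<-≤-trans b<S1+K (ℕP.≤-trans (step K) SK<b)))

<ᵇ-suc : ∀ x k → (x <ᵇ suc k) ≡ ((x <ᵇ k) ∨ (x ≡ᵇ k))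
<ᵇ-suc zero    zero    = refl
<ᵇ-suc zero    (suc k) = refl
<ᵇ-suc (suc x) zero    = refl
<ᵇ-suc (suc x) (suc k) = <ᵇ-suc x k

<ᵇ∧≡ᵇ : ∀ x k → ((x <ᵇ k) ∧ (x ≡ᵇ k)) ≡ false
<ᵇ∧≡ᵇ zero    zero    = refl
<ᵇ∧≡ᵇ zero    (suc k) = refl
<ᵇ∧≡ᵇ (suc x) zero    = refl
<ᵇ∧≡ᵇ (suc x) (suc k) = <ᵇ∧≡ᵇ x k

≡ᵇ⇒≡ : ∀ {x k} → (x ≡ᵇ k) ≡ true → x ≡ k
≡ᵇ⇒≡ {x} {k} e = ℕP.≡ᵇ⇒≡ x k (subst T (sym e) tt)

-- The canonical labelling of an equivalence relation: a vertex is labelled by the number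
-- of class minima below the minimum of its class.
module CanonicalLabelling {n : ℕ} (E : Rel n 2)
  (E-refl : ∀ a → E (a ∷ a ∷ []) ≡ true)
  (E-sym : ∀ a b → E (a ∷ b ∷ []) ≡ true → E (b ∷ a ∷ []) ≡ true)
  (E-trans : ∀ a b c → E (a ∷ b ∷ []) ≡ true → E (b ∷ c ∷ []) ≡ true → E (a ∷ c ∷ []) ≡ true) where

  open KeyOrder {n} toℕ FinP.toℕ-injective using (least; R-least; least-≤)

  E⟨_⟩ : Fin n → Fin n → Bool
  E⟨ u ⟩ w = E (u ∷ w ∷ [])

  rep : Fin n → Fin n
  rep v = least E⟨ v ⟩ (E-refl v)

  E-rep : ∀ v → E⟨ v ⟩ (rep v) ≡ true
  E-rep v = R-least E⟨ v ⟩ (E-refl v)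

  rep-≤ : ∀ {v w} → E⟨ v ⟩ w ≡ true → toℕ (rep v) ℕ.≤ toℕ w
  rep-≤ {v} = least-≤ E⟨ v ⟩ (E-refl v)

  E⇒rep≡ : ∀ {u w} → E⟨ u ⟩ w ≡ true → rep u ≡ rep w
  E⇒rep≡ {u} {w} uw = FinP.toℕ-injective (ℕP.≤-antisym
    (rep-≤ (E-trans u w (rep w) uw (E-rep w)))
    (rep-≤ (E-trans w u (rep u) (E-sym u w uw) (E-rep u))))

  rep≡⇒E : ∀ {u w} → rep u ≡ rep w → E⟨ u ⟩ w ≡ true
  rep≡⇒E {u} {w} eq = E-trans u (rep u) w (E-rep u) (subst (λ z → E⟨ z ⟩ w ≡ true) (sym eq) (E-sym w (rep w) (E-rep w)))

  isRep : Fin n → Bool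
  isRep u = rep u =ᶠ u

  isRep-rep : ∀ v → isRep (rep v) ≡ true
  isRep-rep v rewrite sym (E⇒rep≡ (E-rep v)) = =ᶠ-refl (rep v)

  repsBelow : ℕ → ℕ
  repsBelow k = count (λ u → isRep u ∧ (toℕ u <ᵇ k)) (allFin n)

  repsAt : ℕ → ℕ
  repsAt k = count (λ u → isRep u ∧ (toℕ u ≡ᵇ k)) (allFin n)

  repsBelow-0 : repsBelow 0 ≡ 0
  repsBelow-0 = trans (count-cong-∈ (allFin n) (λ a _ → BoolP.∧-zeroʳ (isRep a))) (none (allFin n))
    where
    none : ∀ xs → count (λ _ → false) xs ≡ 0
    none []       = refl
    none (_ ∷ xs) = none xs

  repsBelow-suc : ∀ k → repsBelow (suc k) ≡ repsBelow k ℕ.+ repsAt k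
  repsBelow-suc k = count-∨ (allFin n)
    (λ a → trans (cong (isRep a ∧_) (<ᵇ-suc (toℕ a) k)) (BoolP.∧-distribˡ-∨ (isRep a) _ _))
    (λ a → disjoint (isRep a) (<ᵇ∧≡ᵇ (toℕ a) k))
    where
    disjoint : ∀ x {y z} → (y ∧ z) ≡ false → ((x ∧ y) ∧ (x ∧ z)) ≡ false
    disjoint false _ = refl
    disjoint true  p = p

  repsAt-witness : ∀ k {c} → repsAt k ≡ suc c → ∃ λ u → isRep u ≡ true × toℕ u ≡ k
  repsAt-witness k e = let (u , _ , q) = count≡suc⇒∃ (allFin n) e in u , ∧-elimˡ q , ≡ᵇ⇒≡ (∧-elimʳ (isRep u) q)

  repsAt-≤1 : ∀ k → repsAt k ℕ.≤ 1
  repsAt-≤1 k with repsAt k in e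
  ... | zero  = ℕ.z≤n
  ... | suc c = let (u , _ , toℕu≡k) = repsAt-witness k e in
    subst (ℕ._≤ 1) e (ℕP.≤-trans (count-mono (allFin n) (only u toℕu≡k))
                                  (ℕP.≤-reflexive (count-single Fin._≟_ (UniqueP.allFin⁺ n) (∈P.∈-allFin u))))
    where
    only : ∀ u → toℕ u ≡ k → ∀ a → (isRep a ∧ (toℕ a ≡ᵇ k)) ≡ true → (u =ᶠ a) ≡ true
    only u toℕu≡k a q = subst (λ z → (u =ᶠ z) ≡ true)
                              (FinP.toℕ-injective (trans toℕu≡k (sym (≡ᵇ⇒≡ (∧-elimʳ (isRep a) q))))) (=ᶠ-refl u)

  repsBelow-strict : ∀ {m k} → isRep m ≡ true → toℕ m ℕ.< k → repsBelow (toℕ m) ℕ.< repsBelow k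
  repsBelow-strict {m} {k} rep-m m<k =
    count-strict (allFin n) (λ a q → ∧-intro (∧-elimˡ q) (<⇒<ᵇ (ℕP.<-trans (<ᵇ⇒< (∧-elimʳ (isRep a) q)) m<k)))
      (∈P.∈-allFin m) (∧-intro rep-m (<⇒<ᵇ m<k)) (trans (cong (isRep m ∧_) (<ᵇ-irrefl (toℕ m))) (BoolP.∧-zeroʳ _))

  classes : ℕ
  classes = repsBelow n

  label : Fin n → ℕ
  label v = repsBelow (toℕ (rep v))

  label<classes : ∀ v → label v ℕ.< classes
  label<classes v = repsBelow-strict (isRep-rep v) (FinP.toℕ<n (rep v))

  label-rep : ∀ {m} → isRep m ≡ true → label m ≡ repsBelow (toℕ m)
  label-rep {m} rep-m = cong (repsBelow ∘ toℕ) (=ᶠ⇒≡ rep-m)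

  label≡⇒E : ∀ {u w} → label u ≡ label w → E⟨ u ⟩ w ≡ true
  label≡⇒E {u} {w} eq = rep≡⇒E reps-equal
    where
    reps-equal : rep u ≡ rep w
    reps-equal with ℕP.<-cmp (toℕ (rep u)) (toℕ (rep w))
    ... | tri≈ _ q _ = FinP.toℕ-injective q
    ... | tri< l _ _ = ⊥-elim (ℕP.<-irrefl eq (repsBelow-strict (isRep-rep u) l))
    ... | tri> _ _ g = ⊥-elim (ℕP.<-irrefl (sym eq) (repsBelow-strict (isRep-rep w) g))

  abstract
    labelled-below : ∀ K {b} → b ℕ.< repsBelow K → ∃ λ u → toℕ u ℕ.< K × label u ≡ b
    labelled-below K b<S =
      let (k , k<K , Sk≡b , S1+k≡1+b) = discrete-ivt repsBelow repsBelow-0 step K b<S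
          (u , rep-u , toℕu≡k) = repsAt-witness k (jump k (trans S1+k≡1+b (cong suc (sym Sk≡b))))
      in u , subst (ℕ._< K) (sym toℕu≡k) k<K , trans (label-rep rep-u) (trans (cong repsBelow toℕu≡k) Sk≡b)
      where
      step : ∀ k → repsBelow (suc k) ℕ.≤ suc (repsBelow k)
      step k = subst (ℕ._≤ suc (repsBelow k)) (sym (repsBelow-suc k))
                     (subst (repsBelow k ℕ.+ repsAt k ℕ.≤_) (ℕP.+-comm (repsBelow k) 1)
                            (ℕP.+-monoʳ-≤ (repsBelow k) (repsAt-≤1 k)))
      jump : ∀ k → repsBelow (suc k) ≡ suc (repsBelow k) → repsAt k ≡ 1
      jump k e = ℕP.+-cancelˡ-≡ (repsBelow k) _ _ (trans (sym (repsBelow-suc k)) (trans e (ℕP.+-comm 1 (repsBelow k))))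

  abstract
    labelling : Vec (Fin classes) n
    labelling = Vec.tabulate (λ v → Fin.fromℕ< (label<classes v))

    toℕ-labelling : ∀ v → toℕ (Vec.lookup labelling v) ≡ label v
    toℕ-labelling v = trans (cong toℕ (VecP.lookup∘tabulate _ v)) (FinP.toℕ-fromℕ< (label<classes v))

  labelling-canonical : isCanonicalPartition labelling ≡ true
  labelling-canonical = ∧-intro (all-intro (allFin classes) λ b _ → surjective b)
                                (all-intro (allFin n) λ v _ → all-intro (allFin classes) λ b _ → growth v b)
    where
    named : ∀ {u b} → label u ≡ toℕ b → (Vec.lookup labelling u =ᶠ b) ≡ true
    named {u} {b} eq = subst (λ z → (Vec.lookup labelling u =ᶠ z) ≡ true)
                             (FinP.toℕ-injective (trans (toℕ-labelling u) eq)) (=ᶠ-refl _)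
    surjective : ∀ b → any (λ v → Vec.lookup labelling v =ᶠ b) (allFin n) ≡ true
    surjective b = let (u , _ , lu≡b) = labelled-below n (FinP.toℕ<n b) in any-intro (allFin n) (∈P.∈-allFin u) (named lu≡b)
    growth : ∀ v b → (not (toℕ b <ᵇ toℕ (Vec.lookup labelling v)) ∨
                      any (λ u → (toℕ u <ᵇ toℕ v) ∧ (Vec.lookup labelling u =ᶠ b)) (allFin n)) ≡ true
    growth v b = by-cases (toℕ b <ᵇ toℕ (Vec.lookup labelling v)) refl
      where
      by-cases : ∀ c → (toℕ b <ᵇ toℕ (Vec.lookup labelling v)) ≡ c →
                 (not c ∨ any (λ u → (toℕ u <ᵇ toℕ v) ∧ (Vec.lookup labelling u =ᶠ b)) (allFin n)) ≡ true
      by-cases false _ = refl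
      by-cases true b<lv =
          let (u , u<rep-v , lu≡b) = labelled-below (toℕ (rep v)) (subst (toℕ b ℕ.<_) (toℕ-labelling v) (<ᵇ⇒< b<lv))
        in any-intro (allFin n) (∈P.∈-allFin u)
             (∧-intro (<⇒<ᵇ (ℕP.<-≤-trans u<rep-v (rep-≤ (E-refl v)))) (named lu≡b))

  E≐kernel : ∀ u w → E⟨ u ⟩ w ≡ (Vec.lookup labelling w =ᶠ Vec.lookup labelling u)
  E≐kernel u w = bool-ext
    (λ uw → subst (λ z → (Vec.lookup labelling w =ᶠ z) ≡ true) (same-label (E-sym u w uw)) (=ᶠ-refl _))
    (λ q → E-sym w u (label≡⇒E (trans (sym (toℕ-labelling w)) (trans (cong toℕ (=ᶠ⇒≡ q)) (toℕ-labelling u)))))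
    where
    same-label : ∀ {u w} → E⟨ u ⟩ w ≡ true → Vec.lookup labelling u ≡ Vec.lookup labelling w
    same-label {u} {w} uw = FinP.toℕ-injective
      (trans (toℕ-labelling u) (trans (cong (repsBelow ∘ toℕ) (E⇒rep≡ uw)) (sym (toℕ-labelling w))))

-- oriented so that the E-class {w | E r w} of r is literally a block of f
kernel : ∀ {n i} → Vec (Fin i) n → Rel n 2
kernel f (u ∷ w ∷ []) = Vec.lookup f w =ᶠ Vec.lookup f u

labellings : (n : ℕ) → List (∃ λ i → Vec (Fin i) n)
labellings n = concatMap (λ i → map (i ,_) (allVecs (allFin i) n)) (upTo (suc n))

canonicalLabellings : (n : ℕ) → List (∃ λ i → Vec (Fin i) n)
canonicalLabellings n = filterᵇ (λ (_ , f) → isCanonicalPartition f) (labellings n)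

module _ {n : ℕ} (E : Rel n 2) where

  isReflexive isSymmetric isTransitive isEquivalence : Bool
  isReflexive  = all (λ a → E (a ∷ a ∷ [])) (allFin n)
  isSymmetric  = all (λ a → all (λ b → not (E (a ∷ b ∷ [])) ∨ E (b ∷ a ∷ [])) (allFin n)) (allFin n)
  isTransitive = all (λ a → all (λ b → all (λ c → not (E (a ∷ b ∷ [])) ∨ (not (E (b ∷ c ∷ [])) ∨ E (a ∷ c ∷ [])))
                                           (allFin n)) (allFin n)) (allFin n)
  isEquivalence = isReflexive ∧ (isSymmetric ∧ isTransitive)

module Equivalence {n : ℕ} (E : Rel n 2) (equivalence : isEquivalence E ≡ true) where

  private
    symmetric : isSymmetric E ≡ true
    symmetric = ∧-elimˡ (∧-elimʳ (isReflexive E) equivalence)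

    transitive : isTransitive E ≡ true
    transitive = ∧-elimʳ (isSymmetric E) (∧-elimʳ (isReflexive E) equivalence)

  E-refl : ∀ a → E (a ∷ a ∷ []) ≡ true
  E-refl a = all-elim (allFin n) (∧-elimˡ equivalence) (∈P.∈-allFin a)

  E-sym : ∀ a b → E (a ∷ b ∷ []) ≡ true → E (b ∷ a ∷ []) ≡ true
  E-sym a b ab = subst (λ z → (not z ∨ E (b ∷ a ∷ [])) ≡ true) ab
    (all-elim (allFin n) (all-elim (allFin n) symmetric (∈P.∈-allFin a)) (∈P.∈-allFin b))

  E-trans : ∀ a b c → E (a ∷ b ∷ []) ≡ true → E (b ∷ c ∷ []) ≡ true → E (a ∷ c ∷ []) ≡ true
  E-trans a b c ab bc =
    subst (λ z → (not z ∨ E (a ∷ c ∷ [])) ≡ true) bc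
      (subst (λ z → (not z ∨ (not (E (b ∷ c ∷ [])) ∨ E (a ∷ c ∷ []))) ≡ true) ab
        (all-elim (allFin n) (all-elim (allFin n) (all-elim (allFin n) transitive (∈P.∈-allFin a)) (∈P.∈-allFin b)) (∈P.∈-allFin c)))

kernel-isEquivalence : ∀ {n i} (f : Vec (Fin i) n) → isEquivalence (kernel f) ≡ true
kernel-isEquivalence {n} f =
  ∧-intro (all-intro (allFin n) λ a _ → =ᶠ-refl (lk a))
          (∧-intro (all-intro (allFin n) λ a _ → all-intro (allFin n) λ b _ → symmetric a b)
                   (all-intro (allFin n) λ a _ → all-intro (allFin n) λ b _ → all-intro (allFin n) λ c _ → transitive a b c))
  where
  lk = Vec.lookup f
  symmetric : ∀ a b → (not (lk b =ᶠ lk a) ∨ (lk a =ᶠ lk b)) ≡ true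
  symmetric a b with lk b =ᶠ lk a in ba
  ... | false = refl
  ... | true  = trans (=ᶠ-sym (lk a) (lk b)) ba
  transitive : ∀ a b c → (not (lk b =ᶠ lk a) ∨ (not (lk c =ᶠ lk b) ∨ (lk c =ᶠ lk a))) ≡ true
  transitive a b c with lk b =ᶠ lk a in ba | lk c =ᶠ lk b in cb
  ... | false | _     = refl
  ... | true  | false = refl
  ... | true  | true  = subst (λ z → (lk c =ᶠ z) ≡ true) (trans (=ᶠ⇒≡ cb) (=ᶠ⇒≡ ba)) (=ᶠ-refl (lk c))

module _ {n : ℕ} (E : Rel n 2) (equivalence : isEquivalence E ≡ true) where

  open Equivalence E equivalence
  open CanonicalLabelling E E-refl E-sym E-trans using (classes; labelling; labelling-canonical; E≐kernel)

  private
    kernel-matches : ∀ {i} (f : Vec (Fin i) n) → (E ≐ kernel f) ≡ true → SameKernel f labelling × SameKernel labelling f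
    kernel-matches f E≐f = f⇒labelling , labelling⇒f
      where
      lk = Vec.lookup
      E≡f : ∀ u w → E (u ∷ w ∷ []) ≡ (lk f w =ᶠ lk f u)
      E≡f u w = ≐⇒≗ {R = E} {Q = kernel f} E≐f (u ∷ w ∷ [])
      f⇒labelling : SameKernel f labelling
      f⇒labelling u w fu≡fw = sym (=ᶠ⇒≡ (trans (sym (E≐kernel u w))
                                (trans (E≡f u w) (subst (λ z → (lk f w =ᶠ z) ≡ true) (sym fu≡fw) (=ᶠ-refl _)))))
      labelling⇒f : SameKernel labelling f
      labelling⇒f u w lu≡lw = sym (=ᶠ⇒≡ (trans (sym (E≡f u w))
                                (trans (E≐kernel u w) (subst (λ z → (lk labelling w =ᶠ z) ≡ true) (sym lu≡lw) (=ᶠ-refl _)))))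

    classes≤n : classes ℕ.≤ n
    classes≤n = subst (classes ℕ.≤_) (ListP.length-tabulate id) (ListP.length-filter (T? ∘ _) (allFin n))

    per-size : ∀ i → ∑ (λ f → 𝟙 (isCanonicalPartition f ∧ (E ≐ kernel f))) (allVecs (allFin i) n)
                     ≡ (if ⌊ classes ℕ.≟ i ⌋ then + 1 else + 0)
    per-size i with classes ℕ.≟ i
    ... | yes refl = trans (∑-cong (λ f → cong 𝟙 (is-labelling f)) (allTuples classes n))
                           (∑-single (VecP.≡-dec Fin._≟_) (allTuples-unique classes n) (∈-allTuples labelling) (λ _ → + 1))
      where
      is-labelling : ∀ f → (isCanonicalPartition f ∧ (E ≐ kernel f)) ≡ (labelling =ᵛ f)
      is-labelling f = bool-ext
        (λ q → let (f⇒l , l⇒f) = kernel-matches f (∧-elimʳ _ q) in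
               subst (λ z → (labelling =ᵛ z) ≡ true)
                     (trans (sym (VecP.tabulate∘lookup labelling))
                            (trans (VecP.tabulate-cong λ v → FinP.toℕ-injective
                                     (sym (canonical-labels-agree f labelling (∧-elimˡ q) labelling-canonical f⇒l l⇒f v)))
                                   (VecP.tabulate∘lookup f)))
                     (=ᵛ-refl labelling))
        (λ q → subst (λ z → (isCanonicalPartition z ∧ (E ≐ kernel z)) ≡ true) (=ᵛ⇒≡ q)
                     (∧-intro labelling-canonical (≗⇒≐ {R = E} {Q = kernel labelling} λ { (u ∷ w ∷ []) → E≐kernel u w })))
    ... | no classes≢i = trans (∑-cong-∈ (allTuples i n) λ f _ → cong 𝟙 (not-canonical-kernel f)) (∑-zero (allTuples i n))
      where
      not-canonical-kernel : ∀ f → (isCanonicalPartition f ∧ (E ≐ kernel f)) ≡ false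
      not-canonical-kernel f with isCanonicalPartition f ∧ (E ≐ kernel f) in q
      ... | false = refl
      ... | true  = let (f⇒l , l⇒f) = kernel-matches f (∧-elimʳ _ q) in
                    ⊥-elim (classes≢i (sym (canonical-sizes-agree f labelling (∧-elimˡ q) labelling-canonical f⇒l l⇒f)))

  ∑-canonical-kernel : ∑ (λ (_ , f) → 𝟙 (E ≐ kernel f)) (canonicalLabellings n) ≡ + 1
  ∑-canonical-kernel = begin
      ∑ (λ (_ , f) → 𝟙 (E ≐ kernel f)) (canonicalLabellings n)
    ≡⟨ ∑-filterᵇ _ _ (labellings n) ⟩
      ∑ (λ (_ , f) → if isCanonicalPartition f then 𝟙 (E ≐ kernel f) else + 0) (labellings n)
    ≡⟨ ∑-cong (λ (_ , f) → if-𝟙 (isCanonicalPartition f)) (labellings n) ⟩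
      ∑ F (labellings n)
    ≡⟨ ∑-concatMap F (λ i → map (i ,_) (allVecs (allFin i) n)) (upTo (suc n)) ⟩
      ∑ (λ i → ∑ F (map (i ,_) (allVecs (allFin i) n))) (upTo (suc n))
    ≡⟨ ∑-cong (λ i → trans (∑-map F (i ,_) (allVecs (allFin i) n)) (per-size i)) (upTo (suc n)) ⟩
      ∑ (λ i → if ⌊ classes ℕ.≟ i ⌋ then + 1 else + 0) (upTo (suc n))
    ≡⟨ ∑-single ℕ._≟_ (UniqueP.upTo⁺ (suc n)) (∈P.∈-upTo⁺ (ℕ.s≤s classes≤n)) (λ _ → + 1) ⟩
      + 1 ∎
    where
    open ≡-Reasoning
    F : (∃ λ i → Vec (Fin i) n) → ℤ
    F (_ , f) = 𝟙 (isCanonicalPartition f ∧ (E ≐ kernel f))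
    if-𝟙 : ∀ b {c} → (if b then 𝟙 c else + 0) ≡ 𝟙 (b ∧ c)
    if-𝟙 true  = refl
    if-𝟙 false = refl

allBlocks : (Graph → Bool) → (G : Graph) → ∀ {i} → Vec (Fin i) (size G) → Bool
allBlocks P G {i} f = all (λ b → P (induced G (block G f b))) (allFin i)

hararySum : (Graph → Bool) → (G : Graph) → (ℕ → ℤ) → ℤ
hararySum P G w = ∑ (λ (i , f) → if allBlocks P G f then w i else + 0) (canonicalLabellings (size G))

hararySum-cong : ∀ {P Q w w′} → (∀ G → P G ≡ Q G) → (∀ i → w i ≡ w′ i) →
  ∀ G → hararySum P G w ≡ hararySum Q G w′
hararySum-cong P≗Q w≗w′ G = ∑-cong (λ (i , f) → cong₂ (λ b v → if b then v else + 0)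
                                       (all-cong (λ b → P≗Q (induced G (block G f b))) (allFin i)) (w≗w′ i))
                                     (canonicalLabellings (size G))

harary≡hararySum : ∀ P G x → harary P G x ≡ hararySum P G (fall x)
harary≡hararySum P G x = begin
    ∑ (λ i → + bCount P G i * fall x i) (upTo (suc n))
  ≡⟨ ∑-cong per-size (upTo (suc n)) ⟩
    ∑ (λ i → ∑ (λ f → F (i , f)) (allVecs (allFin i) n)) (upTo (suc n))
  ≡⟨ ∑-cong (λ i → sym (∑-map F (i ,_) (allVecs (allFin i) n))) (upTo (suc n)) ⟩
    ∑ (λ i → ∑ F (map (i ,_) (allVecs (allFin i) n))) (upTo (suc n))
  ≡⟨ sym (∑-concatMap F (λ i → map (i ,_) (allVecs (allFin i) n)) (upTo (suc n))) ⟩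
    ∑ F (labellings n)
  ≡⟨ ∑-cong (λ (i , f) → if-∧ (isCanonicalPartition f)) (labellings n) ⟩
    ∑ (λ (i , f) → if isCanonicalPartition f then (if allBlocks P G f then fall x i else + 0) else + 0) (labellings n)
  ≡⟨ sym (∑-filterᵇ _ _ (labellings n)) ⟩
    hararySum P G (fall x) ∎
  where
  open ≡-Reasoning
  n = size G
  F : (∃ λ i → Vec (Fin i) n) → ℤ
  F (i , f) = if isCanonicalPartition f ∧ allBlocks P G f then fall x i else + 0
  per-size : ∀ i → + bCount P G i * fall x i ≡ ∑ (λ f → F (i , f)) (allVecs (allFin i) n)
  per-size i = trans (cong (_* fall x i) (length-filterᵇ _ (allVecs (allFin i) n)))
                     (trans (sym (∑-*ʳ (fall x i) _ (allVecs (allFin i) n)))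
                            (∑-cong (λ f → 𝟙* (isCanonicalPartition f ∧ allBlocks P G f)) (allVecs (allFin i) n)))
    where
    𝟙* : ∀ b → 𝟙 b * fall x i ≡ (if b then fall x i else + 0)
    𝟙* true  = ℤP.*-identityˡ (fall x i)
    𝟙* false = refl
  if-∧ : ∀ b {c} {v : ℤ} → (if b ∧ c then v else + 0) ≡ (if b then (if c then v else + 0) else + 0)
  if-∧ true  = refl
  if-∧ false = refl

module Expansion (φ : Sentence) (G : Graph) (π : Permutation′ (size G)) (y : Fin 2 → ℤ) where

  open Choices G π y

  classOf : Rel n 2 → Fin n → List (Fin n)
  classOf E r = filterᵇ (λ w → E (r ∷ w ∷ [])) (allFin n)

  blocksSatisfy : Rel n 2 → Bool
  blocksSatisfy E = all (λ r → models φ (induced G (classOf E r))) (allFin n)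

  summand : Rel n 2 → Rel n 2 → ℤ
  summand E C = if eval G _≺_ noVars (env E C) (hararyF φ) then weight (env E C) else + 0

  sumOverChoices : Rel n 2 → ℤ
  sumOverChoices E = ∑ (summand E) (allRels n 2)

  unfold : ⟦ hararyExpr φ ⟧ G _≺_ y ≡ ∑ sumOverChoices (allRels n 2)
  unfold = begin
      ∑ weight (filterᵇ (λ ρ → eval G _≺_ noVars ρ (hararyF φ)) (allEnvs n Γ₀))
    ≡⟨ ∑-filterᵇ weight _ (allEnvs n Γ₀) ⟩
      ∑ S (allEnvs n Γ₀)
    ≡⟨ ∑-concatMap S (λ E → map (extEnv E) (allEnvs n (2 ∷ []))) (allRels n 2) ⟩
      ∑ (λ E → ∑ S (map (extEnv E) (allEnvs n (2 ∷ [])))) (allRels n 2)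
    ≡⟨ ∑-cong (λ E → trans (∑-map S (extEnv E) (allEnvs n (2 ∷ [])))
                     (trans (∑-concatMap (S ∘ extEnv E) (λ C → map (extEnv C) (emptyEnv ∷ [])) (allRels n 2))
                            (∑-cong (λ C → ℤP.+-identityʳ _) (allRels n 2)))) (allRels n 2) ⟩
      ∑ sumOverChoices (allRels n 2) ∎
    where
    open ≡-Reasoning
    S : REnv n Γ₀ → ℤ
    S ρ = if eval G _≺_ noVars ρ (hararyF φ) then weight ρ else + 0

  relativised-blocks : ∀ E C → eval G _≺_ noVars (env E C) (all₁ (relativise φ)) ≡ blocksSatisfy E
  relativised-blocks E C = all-cong (λ r → sym (relativise-correct G (classOf E r) (filterᵇ⁺ _ (UniqueP.allFin⁺ n))
      φ _≺_ (λ _ _ → false) noVars (extVal r noVars) emptyEnv (env E C) (λ ()) (λ _ ())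
      (λ w Erw → ∈-filterᵇ⁺ (λ w → E (r ∷ w ∷ [])) (allFin n) (∈P.∈-allFin w) Erw)
      (λ w w∈ → proj₂ (∈-filterᵇ⁻ (λ w → E (r ∷ w ∷ [])) (allFin n) w∈)))) (allFin n)

  sumOverChoices≡ : ∀ E → sumOverChoices E ≡
    (if isEquivalence E ∧ blocksSatisfy E then fallingBy y₀ y₁ (count (isLeast E) (allFin n)) else + 0)
  sumOverChoices≡ E = trans (∑-cong split (allRels n 2)) (by-cases (isEquivalence E ∧ blocksSatisfy E))
    where
    split : ∀ C → summand E C ≡ (if isEquivalence E ∧ blocksSatisfy E then choiceTerm E C else + 0)
    split C = trans (cong (λ c → if (isEquivalence E ∧ c) ∧ isChoice E C then weight (env E C) else + 0)
                          (relativised-blocks E C))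
                    (guarded (isEquivalence E ∧ blocksSatisfy E))
      where
      guarded : ∀ b → (if b ∧ isChoice E C then weight (env E C) else + 0) ≡ (if b then choiceTerm E C else + 0)
      guarded true  = refl
      guarded false = refl
    by-cases : ∀ b → ∑ (λ C → if b then choiceTerm E C else + 0) (allRels n 2)
                     ≡ (if b then fallingBy y₀ y₁ (count (isLeast E) (allFin n)) else + 0)
    by-cases true  = ∑-choices E
    by-cases false = ∑-zero (allRels n 2)

  sumOverChoices-resp : ∀ {E E′} → (E ≐ E′) ≡ true → sumOverChoices E ≡ sumOverChoices E′
  sumOverChoices-resp {E} {E′} E≐E′ = ∑-cong (λ C → cong₂ (λ b v → if b then v else + 0)
      (eval-cong G _≺_ noVars (same C) (hararyF φ)) (weight-cong (same C))) (allRels n 2)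
    where
    same : ∀ C → env E C ≗ᴱ env E′ C
    same C _ here         t = ≐⇒≗ {R = E} {Q = E′} E≐E′ t
    same C _ (there here) t = refl

  module _ {i : ℕ} (f : Vec (Fin i) n) (canonical : isCanonicalPartition f ≡ true) where

    blocksSatisfy-kernel : blocksSatisfy (kernel f) ≡ allBlocks (models φ) G f
    blocksSatisfy-kernel = bool-ext
      (λ q → all-intro (allFin i) λ b _ → let (r , fr≡b) = canonical-surjective f canonical b in
               subst (λ z → models φ (induced G (block G f z)) ≡ true) fr≡b (all-elim (allFin n) q (∈P.∈-allFin r)))
      (λ q → all-intro (allFin n) λ r _ → all-elim (allFin i) q (∈P.∈-allFin (Vec.lookup f r)))

    private
      lk = Vec.lookup f
      L = isLeast (kernel f)

    ∑-block-isLeast : ∀ b → ∑ (λ v → if lk v =ᶠ b then 𝟙 (L v) else + 0) (allFin n) ≡ + 1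
    ∑-block-isLeast b = trans (∑-cong least-only (allFin n)) (∑-single Fin._≟_ (UniqueP.allFin⁺ n) (∈P.∈-allFin m) (λ _ → + 1))
      where
      inBlock : Fin n → Bool
      inBlock v = lk v =ᶠ b
      v₀∈ : inBlock (proj₁ (canonical-surjective f canonical b)) ≡ true
      v₀∈ = subst (λ z → (lk (proj₁ (canonical-surjective f canonical b)) =ᶠ z) ≡ true)
                  (proj₂ (canonical-surjective f canonical b)) (=ᶠ-refl _)
      m = least inBlock v₀∈
      m∈ : inBlock m ≡ true
      m∈ = R-least inBlock v₀∈
      m≺ : ∀ {v} → inBlock v ≡ true → m ≢ v → (m ≺ v) ≡ true
      m≺ = least-≺ inBlock v₀∈
      same-block : ∀ {v} → inBlock v ≡ true → (lk m =ᶠ lk v) ≡ true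
      same-block v∈ = subst (λ z → (lk m =ᶠ z) ≡ true) (trans (=ᶠ⇒≡ m∈) (sym (=ᶠ⇒≡ v∈))) (=ᶠ-refl (lk m))
      L-m : L m ≡ true
      L-m = all-intro (allFin n) λ u _ → at u
        where
        at : ∀ u → (not (lk u =ᶠ lk m) ∨ not (u ≺ m)) ≡ true
        at u with lk u =ᶠ lk m in um
        ... | false = refl
        ... | true with m Fin.≟ u
        ...   | yes refl = false⇒not-true (≺-irrefl u)
        ...   | no m≢u   = false⇒not-true (≺-asym (m≺ (trans (cong (_=ᶠ b) (=ᶠ⇒≡ um)) m∈) m≢u))
      least-only : ∀ v → (if inBlock v then 𝟙 (L v) else + 0) ≡ (if m =ᶠ v then + 1 else + 0)
      least-only v = trans (if-𝟙 (inBlock v)) (cong 𝟙 (bool-ext is-m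
        (λ q → subst (λ z → (inBlock z ∧ L z) ≡ true) (=ᶠ⇒≡ q) (∧-intro m∈ L-m))))
        where
        if-𝟙 : ∀ c → (if c then 𝟙 (L v) else + 0) ≡ 𝟙 (c ∧ L v)
        if-𝟙 true  = refl
        if-𝟙 false = refl
        is-m : (inBlock v ∧ L v) ≡ true → (m =ᶠ v) ≡ true
        is-m q with m Fin.≟ v
        ... | yes refl = refl
        ... | no m≢v = ⊥-elim (true≢false (trans (sym (all-elim (allFin n) (∧-elimʳ (inBlock v) q) (∈P.∈-allFin m)))
                         (cong₂ (λ c d → not c ∨ not d) (same-block (∧-elimˡ q)) (m≺ (∧-elimˡ q) m≢v))))

    count-isLeast-kernel : count L (allFin n) ≡ i
    count-isLeast-kernel = ℤP.+-injective (begin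
        + count L (allFin n)
      ≡⟨ length-filterᵇ L (allFin n) ⟩
        ∑ (𝟙 ∘ L) (allFin n)
      ≡⟨ ∑-cong (λ v → sym (∑-single Fin._≟_ (UniqueP.allFin⁺ i) (∈P.∈-allFin (lk v)) (λ _ → 𝟙 (L v)))) (allFin n) ⟩
        ∑ (λ v → ∑ (λ b → if lk v =ᶠ b then 𝟙 (L v) else + 0) (allFin i)) (allFin n)
      ≡⟨ ∑-swap (λ v b → if lk v =ᶠ b then 𝟙 (L v) else + 0) (allFin n) (allFin i) ⟩
        ∑ (λ b → ∑ (λ v → if lk v =ᶠ b then 𝟙 (L v) else + 0) (allFin n)) (allFin i)
      ≡⟨ ∑-cong ∑-block-isLeast (allFin i) ⟩
        ∑ (λ _ → + 1) (allFin i)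
      ≡⟨ trans (∑-ones (allFin i)) (cong +_ (ListP.length-tabulate id)) ⟩
        + i ∎)
      where open ≡-Reasoning

    sumOverChoices-kernel : sumOverChoices (kernel f) ≡ (if allBlocks (models φ) G f then fallingBy y₀ y₁ i else + 0)
    sumOverChoices-kernel = trans (sumOverChoices≡ (kernel f))
      (cong₂ (λ c k → if c then fallingBy y₀ y₁ k else + 0)
             (cong₂ _∧_ (kernel-isEquivalence f) blocksSatisfy-kernel) count-isLeast-kernel)

  ⟦hararyExpr⟧≡hararySum : ⟦ hararyExpr φ ⟧ G _≺_ y ≡ hararySum (models φ) G (fallingBy y₀ y₁)
  ⟦hararyExpr⟧≡hararySum = begin
      ⟦ hararyExpr φ ⟧ G _≺_ y
    ≡⟨ unfold ⟩
      ∑ sumOverChoices (allRels n 2)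
    ≡⟨ ∑-allRels-reindex sumOverChoices (λ (_ , f) → kernel f) (canonicalLabellings n)
                         (λ {E} {E′} → sumOverChoices-resp {E} {E′}) one-preimage ⟩
      ∑ (λ (_ , f) → sumOverChoices (kernel f)) (canonicalLabellings n)
    ≡⟨ ∑-cong-∈ (canonicalLabellings n)
                (λ (_ , f) f∈ → sumOverChoices-kernel f (proj₂ (∈-filterᵇ⁻ _ (labellings n) f∈))) ⟩
      hararySum (models φ) G (fallingBy y₀ y₁) ∎
    where
    open ≡-Reasoning
    one-preimage : ∀ E → sumOverChoices E ≡ + 0 ⊎ ∑ (λ (_ , f) → 𝟙 (E ≐ kernel f)) (canonicalLabellings n) ≡ + 1
    one-preimage E = by-equivalence (isEquivalence E) refl
      where
      by-equivalence : ∀ b → isEquivalence E ≡ b →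
        sumOverChoices E ≡ + 0 ⊎ ∑ (λ (_ , f) → 𝟙 (E ≐ kernel f)) (canonicalLabellings n) ≡ + 1
      by-equivalence true  equivalence = inj₂ (∑-canonical-kernel E equivalence)
      by-equivalence false not-equivalence = inj₁ (trans (sumOverChoices≡ E)
        (cong (λ c → if c ∧ blocksSatisfy E then fallingBy y₀ y₁ (count (isLeast E) (allFin n)) else + 0) not-equivalence))

-- x₀ ↦ x and x₁ ↦ -1, turning fallingBy x₀ x₁ into the falling factorial
hararySubst : Fin 2 → List ℤ
hararySubst Fin.zero           = + 0 ∷ + 1 ∷ []
hararySubst (Fin.suc Fin.zero) = - + 1 ∷ []

fall≡fallingBy-hararySubst : ∀ x i →
  fall x i ≡ fallingBy (evalPoly (hararySubst Fin.zero) x) (evalPoly (hararySubst (Fin.suc Fin.zero)) x) i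
fall≡fallingBy-hararySubst x i =
  trans (sym (fallingBy-−1 x i)) (cong₂ (λ y₀ y₁ → fallingBy y₀ y₁ i) (sym x≡) (sym −1≡))
  where
  x≡ : evalPoly (hararySubst Fin.zero) x ≡ x
  x≡ = trans (ℤP.+-identityˡ _) (trans (cong (x *_) (cong (_+_ (+ 1)) (ℤP.*-zeroʳ x))) (ℤP.*-identityʳ x))
  −1≡ : evalPoly (hararySubst (Fin.suc Fin.zero)) x ≡ - + 1
  −1≡ = cong (_+_ (- + 1)) (ℤP.*-zeroʳ x)

proposition4 : (P : Graph → Bool) → SOLDefinableProperty P →
    SOLDefinablePoly (harary P)
proposition4 P (φ , P≗φ) = 2 , hararyExpr φ , hararySubst , invariant , expansion
  where
  expand : ∀ G (π : Permutation′ (size G)) y →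
    ⟦ hararyExpr φ ⟧ G (orderOf π) y ≡ hararySum (models φ) G (fallingBy (y Fin.zero) (y (Fin.suc Fin.zero)))
  expand G π y = Expansion.⟦hararyExpr⟧≡hararySum φ G π y

  invariant : OrderInvariant (hararyExpr φ)
  invariant G π π′ y = trans (expand G π y) (sym (expand G π′ y))

  expansion : ∀ G (π : Permutation′ (size G)) x →
    harary P G x ≡ ⟦ hararyExpr φ ⟧ G (orderOf π) (λ j → evalPoly (hararySubst j) x)
  expansion G π x = trans (harary≡hararySum P G x)
    (trans (hararySum-cong P≗φ (fall≡fallingBy-hararySubst x) G) (sym (expand G π (λ j → evalPoly (hararySubst j) x))))
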